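{- Let $d=(d_1,\dots,d_n)$ be a graphic list (the degree sequence of some simple graph on vertex set $[n]=\{1,\dots,n\}$). Let $P(d)\subseteq\mathbb{R}^{\binom{n}{2}}$ be the set of all points $x=(x_{ij})$, with coordinates indexed by unordered pairs $\{i,j\}$ of distinct elements of $[n]$, satisfying $$\sum_{i\in[n],\, i\neq j} x_{ij}=d_j\quad (1\le j\le n),\qquad 0\le x_{ij}\le 1\quad(1\le i<j\le n).$$ Let $h\in P(d)$, and let $R_h$ be the graph on $[n]$ whose edges are the pairs $ij$ for which $h_{ij}$ is not an integer. Then $h$ is a vertex (extreme point) of $P(d)$ if and only if the edges of $R_h$ form vertex-disjoint odd cycles (i.e., every vertex of $R_h$ has degree $0$ or $2$ and every cycle of $R_h$ has odd length). Furthermore, if $h$ is a vertex of $P(d)$, then the number of these cycles is even and every nonintegral coordinate of $h$ equals $1/2$.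
   Context: Here $x_{ij}$ and $x_{ji}$ denote the same coordinate. The point $h$ may be viewed as a labeling of the edges of the complete graph on $[n]$ (a "fractional realization" of $d$), where edge $ij$ receives label $h_{ij}$.
   Formalization: The polytope P(d) is taken in ℚ^(n choose 2) instead of $\mathbb{R}^{\binom{n}{2}}$, so h and the points and convex weights in the definition of an extreme point are rational. -}

module Defs where

open import Data.Nat as ℕ using (ℕ; zero; suc)
open import Data.Integer using (ℤ; +_)
open import Data.Rational as ℚ using (ℚ; 0ℚ; 1ℚ; _/_)
open import Data.Fin using (Fin; zero; suc; toℕ)
open import Data.Bool using (Bool; true; false; if_then_else_)
open import Data.List using (List; length; lookup)
open import Data.Product using (Σ; ∃; _×_; _,_)
open import Data.Sum using (_⊎_)
open import Relation.Nullary using (¬_)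
open import Relation.Binary.PropositionalEquality using (_≡_; _≢_)
open import Relation.Nullary.Decidable using (⌊_⌋)
open import Function.Definitions using (Injective)
open import Data.Fin using (_≟_)

sumℕ : ∀ {n} → (Fin n → ℕ) → ℕ
sumℕ {zero} f = 0
sumℕ {suc n} f = f zero ℕ.+ sumℕ (λ i → f (suc i))

sumℚ : ∀ {n} → (Fin n → ℚ) → ℚ
sumℚ {zero} f = 0ℚ
sumℚ {suc n} f = f zero ℚ.+ sumℚ (λ i → f (suc i))

ℕ→ℚ : ℕ → ℚ
ℕ→ℚ k = (+ k) / 1

record SimpleGraph (n : ℕ) : Set where
  field
    adj   : Fin n → Fin n → Bool
    sym   : ∀ i j → adj i j ≡ adj j i
    irrefl : ∀ i → adj i i ≡ false

boolToℕ : Bool → ℕ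
boolToℕ true = 1
boolToℕ false = 0

degree : ∀ {n} → SimpleGraph n → Fin n → ℕ
degree G j = sumℕ (λ i → boolToℕ (SimpleGraph.adj G i j))

Graphic : ∀ {n} → (Fin n → ℕ) → Set
Graphic {n} d = ∃ λ (G : SimpleGraph n) → ∀ j → degree G j ≡ d j

-- Points of ℚ^(n choose 2): coordinates x i j for i ≢ j, with x i j = x j i.
-- We represent them as functions on ordered pairs that are symmetric and
-- vanish on the (meaningless) diagonal, so representation is canonical.

Point : ℕ → Set
Point n = Fin n → Fin n → ℚ

offDiagColSum : ∀ {n} → Point n → Fin n → ℚ
offDiagColSum x j = sumℚ (λ i → if ⌊ i ≟ j ⌋ then 0ℚ else x i j)

InP : ∀ {n} → (Fin n → ℕ) → Point n → Set
InP {n} d x =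
    (∀ i j → x i j ≡ x j i)
  × (∀ i → x i i ≡ 0ℚ)
  × (∀ j → offDiagColSum x j ≡ ℕ→ℚ (d j))
  × (∀ i j → i ≢ j → (0ℚ ℚ.≤ x i j) × (x i j ℚ.≤ 1ℚ))

IsVertex : ∀ {n} → (Fin n → ℕ) → Point n → Set
IsVertex {n} d h =
  InP d h ×
  (∀ (a b : Point n) (t : ℚ) → InP d a → InP d b →
     0ℚ ℚ.< t → t ℚ.< 1ℚ →
     (∀ i j → h i j ≡ (t ℚ.* a i j) ℚ.+ ((1ℚ ℚ.- t) ℚ.* b i j)) →
     ∀ i j → a i j ≡ b i j)

IsIntegral : ℚ → Set
IsIntegral q = ∃ λ (z : ℤ) → q ≡ z / 1

REdge : ∀ {n} → Point n → Fin n → Fin n → Set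
REdge h i j = i ≢ j × ¬ IsIntegral (h i j)

record Cycle (n : ℕ) : Set where
  field
    len    : ℕ
    len≥3  : 3 ℕ.≤ len
    vert   : Fin len → Fin n
    inj    : Injective _≡_ _≡_ vert

CycSucc : ∀ {len} → Fin len → Fin len → Set
CycSucc {len} m m' = (suc (toℕ m) ≡ toℕ m') ⊎ ((suc (toℕ m) ≡ len) × (toℕ m' ≡ 0))

CycleEdge : ∀ {n} → Cycle n → Fin n → Fin n → Set
CycleEdge C i j =
  ∃ λ m → ∃ λ m' → CycSucc m m' ×
    (((vert m ≡ i) × (vert m' ≡ j)) ⊎ ((vert m ≡ j) × (vert m' ≡ i)))
  where open Cycle C

OddCycle : ∀ {n} → Cycle n → Set
OddCycle C = Cycle.len C ℕ.% 2 ≡ 1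

OddCycleDecomposition : ∀ {n} → Point n → List (Cycle n) → Set
OddCycleDecomposition {n} h Cs =
    (∀ p → OddCycle (lookup Cs p))
  × (∀ p q → p ≢ q → ∀ a b →
       Cycle.vert (lookup Cs p) a ≢ Cycle.vert (lookup Cs q) b)
  × (∀ i j → (REdge h i j → ∃ λ p → CycleEdge (lookup Cs p) i j)
           × ((∃ λ p → CycleEdge (lookup Cs p) i j) → REdge h i j))

{-# OPTIONS --safe #-}
module Submission where

-- Call δ balanced if it is symmetric, has zero column sums and vanishes off the fractional
-- coordinates of h.  Then h is a vertex iff every balanced δ is 0: a nonzero δ gives
-- h = ½ (h + εδ) + ½ (h - εδ) inside P(d) for small ε, and h = t a + (1 - t) b makes a - b balanced.
-- Column sums are integers, so next to each fractional edge lies another one, and ±1 alternating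
-- along an even closed walk that passes some vertex once is a nonzero balanced δ.  In a graph with
-- these two properties every vertex lies on an odd cycle and has at most two neighbours, so the
-- fractional edges form vertex-disjoint odd cycles.  Conversely, along such cycles the two entries
-- of a column at a cycle vertex have a fixed sum (0 for a balanced δ, 1 for h, being an integer in
-- (0, 2)), and an odd cycle forces every edge to carry half of it: δ = 0 and h = ½.  Finally
-- d j = #{i : h i j = 1} + [j lies on a cycle]; the handshake lemma for d and for the 1-entries shows
-- that the cycles have even total length, so, being odd, there is an even number of them.

open import Defs
open import Data.Nat using (ℕ; _%_)
open import Data.Rational using (ℚ; ½)
open import Data.Fin using (Fin)
open import Data.List using (List; length)
open import Data.Product using (∃; _×_)
open import Relation.Binary.PropositionalEquality using (_≡_)
open import Function.Bundles using (_⇔_)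

open import Algebra.Bundles using (CommutativeMonoid; CommutativeRing; Semiring)
import Algebra.Properties.CommutativeMonoid.Sum as CommutativeMonoidSum
import Algebra.Properties.CommutativeSemigroup as CommutativeSemigroupProperties
import Algebra.Properties.Semiring.Sum as SemiringSum
open import Data.Bool using (if_then_else_)
open import Data.Empty using (⊥; ⊥-elim)
open import Data.Fin as Fin using (Fin; zero; suc; toℕ; _≟_)
import Data.Fin.Properties as FinP
open import Data.Integer as ℤ using (ℤ; +_; -[1+_]; +[1+_])
import Data.Integer.Properties as ℤP
open import Data.List as List using (List; []; _∷_; _++_; length; reverse; [_])
import Data.List.Properties as ListP
open import Data.List.Membership.Propositional using (_∈_; _∉_)
open import Data.List.Membership.Propositional.Properties using (∈-++⁺ˡ; ∈-++⁺ʳ; ∈-++⁻; ∈-∃++; ∈-lookup; ∈-allFin)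
open import Data.List.Relation.Unary.All as All using (All; []; _∷_)
import Data.List.Relation.Unary.All.Properties as AllP
open import Data.List.Relation.Unary.AllPairs as AllPairs using (AllPairs; []; _∷_)
open import Data.List.Relation.Unary.Any as Any using (Any; here; there)
import Data.List.Relation.Unary.Any.Properties as AnyP
open import Data.List.Relation.Unary.Linked as Linked using (Linked; []; [-]; _∷_)
open import Data.List.Relation.Unary.Unique.Propositional using (Unique)
open import Data.List.Relation.Unary.Unique.Propositional.Properties using (Unique[x∷xs]⇒x∉xs)
open import Data.Nat as ℕ using (ℕ; zero; suc; _+_; parity)
import Data.Nat.Coprimality as Coprimality
import Data.Nat.Properties as ℕP
open import Data.Parity as ℙ using (0ℙ; 1ℙ; _⁻¹)
import Data.Parity.Properties as ℙP
open import Data.Product using (∃; ∃₂; _×_; _,_; proj₁; proj₂)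
open import Data.Rational as ℚ using (ℚ; 0ℚ; 1ℚ; ½; _/_; mkℚ)
import Data.Rational.Properties as ℚP
open import Data.Rational.Solver using (module +-*-Solver)
import Data.Rational.Unnormalised as ℚᵘ
import Data.Rational.Unnormalised.Properties as ℚᵘP
open import Data.Sum using (_⊎_; inj₁; inj₂; [_,_]′)
open import Data.Vec.Functional using (updateAt)
open import Data.Vec.Functional.Properties using (updateAt-updates; updateAt-minimal)
open import Function using (_∘_; const)
open import Function.Bundles using (mk⇔)
open import Level using (0ℓ)
open import Relation.Binary.Definitions using (tri<; tri≈; tri>)
open import Relation.Binary.PropositionalEquality
  using (_≡_; _≢_; refl; sym; trans; cong; cong₂; subst; subst₂; module ≡-Reasoning)
open import Relation.Nullary using (¬_; Dec; yes; no)
open import Relation.Nullary.Decidable using (⌊_⌋; _×-dec_; ¬?)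
open import Relation.Unary using (Pred; Decidable)

open +-*-Solver

module SumLemmas {c ℓ} (M : CommutativeMonoid c ℓ) where
  open CommutativeMonoid M
    using (Carrier; _≈_; _∙_; ∙-congˡ; ∙-congʳ; setoid; reflexive; identityˡ; identityʳ; commutativeSemigroup)
    renaming (ε to 0#)
  open CommutativeMonoidSum M using (sum; sum-cong-≋; sum-replicate-zero)
  open CommutativeSemigroupProperties commutativeSemigroup using (x∙yz≈y∙xz)
  open import Relation.Binary.Reasoning.Setoid setoid
  private module M = CommutativeMonoid M

  sum-updateAt-0# : ∀ {n} (f : Fin n → Carrier) a →
                    sum f ≈ f a ∙ sum (updateAt f a (const 0#))
  sum-updateAt-0# {suc n} f zero = ∙-congˡ (M.sym (identityˡ _))
  sum-updateAt-0# {suc n} f (suc a) = begin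
    f zero ∙ sum (f ∘ suc)                                         ≈⟨ ∙-congˡ (sum-updateAt-0# (f ∘ suc) a) ⟩
    f zero ∙ (f (suc a) ∙ sum (updateAt (f ∘ suc) a (const 0#)))  ≈⟨ x∙yz≈y∙xz _ _ _ ⟩
    f (suc a) ∙ (f zero ∙ sum (updateAt (f ∘ suc) a (const 0#)))  ∎

  sum-zero : ∀ {n} (f : Fin n → Carrier) → (∀ i → f i ≈ 0#) → sum f ≈ 0#
  sum-zero {n} f f≈0 = M.trans (sum-cong-≋ f≈0) (sum-replicate-zero n)

  without₂ : ∀ {n} → (Fin n → Carrier) → Fin n → Fin n → Fin n → Carrier
  without₂ f a b = updateAt (updateAt f a (const 0#)) b (const 0#)

  sum-without₂ : ∀ {n} (f : Fin n → Carrier) {a b} → a ≢ b → sum f ≈ f a ∙ (f b ∙ sum (without₂ f a b))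
  sum-without₂ f {a} {b} a≢b = begin
    sum f                                                      ≈⟨ sum-updateAt-0# f a ⟩
    f a ∙ sum (updateAt f a (const 0#))                        ≈⟨ ∙-congˡ (sum-updateAt-0# _ b) ⟩
    f a ∙ (updateAt f a (const 0#) b ∙ sum (without₂ f a b))   ≈⟨ ∙-congˡ (∙-congʳ (reflexive (updateAt-minimal b a f (a≢b ∘ sym)))) ⟩
    f a ∙ (f b ∙ sum (without₂ f a b))                         ∎

  without₂-pointwise : ∀ {p} (P : Carrier → Set p) {n} (f : Fin n → Carrier) a b →
                       P 0# → (∀ i → i ≢ a → i ≢ b → P (f i)) → ∀ i → P (without₂ f a b i)
  without₂-pointwise P f a b P0 Pf i with i ≟ b
  ... | yes refl = subst P (sym (updateAt-updates i _)) P0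
  ... | no i≢b with i ≟ a
  ...   | yes refl = subst P (sym (trans (updateAt-minimal i b _ i≢b) (updateAt-updates i f))) P0
  ...   | no i≢a = subst P (sym (trans (updateAt-minimal i b _ i≢b) (updateAt-minimal i a f i≢a))) (Pf i i≢a i≢b)

  sum-supported-at : ∀ {n} (f : Fin n → Carrier) a → (∀ i → i ≢ a → f i ≈ 0#) → sum f ≈ f a
  sum-supported-at f a f≈0 = begin
    sum f                                    ≈⟨ sum-updateAt-0# f a ⟩
    f a ∙ sum (updateAt f a (const 0#))      ≈⟨ ∙-congˡ (sum-zero _ vanishes) ⟩
    f a ∙ 0#                                 ≈⟨ identityʳ (f a) ⟩
    f a                                      ∎
    where
    vanishes : ∀ i → updateAt f a (const 0#) i ≈ 0#
    vanishes i with i ≟ a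
    ... | yes refl = reflexive (updateAt-updates a f)
    ... | no i≢a = M.trans (reflexive (updateAt-minimal i a f i≢a)) (f≈0 i i≢a)

ℚ-semiring : Semiring 0ℓ 0ℓ
ℚ-semiring = CommutativeRing.semiring ℚP.+-*-commutativeRing

module ℚΣ where
  open SemiringSum ℚ-semiring public
  open SumLemmas (Semiring.+-commutativeMonoid ℚ-semiring) public

module ℕΣ where
  open SemiringSum ℕP.+-*-semiring public
  open SumLemmas ℕP.+-0-commutativeMonoid public

sumℚ≡∑ : ∀ {n} (f : Fin n → ℚ) → sumℚ f ≡ ℚΣ.sum f
sumℚ≡∑ {zero} f = refl
sumℚ≡∑ {suc n} f = cong (f zero ℚ.+_) (sumℚ≡∑ (f ∘ suc))

sumℕ≡∑ : ∀ {n} (f : Fin n → ℕ) → sumℕ f ≡ ℕΣ.sum f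
sumℕ≡∑ {zero} f = refl
sumℕ≡∑ {suc n} f = cong (f zero ℕ.+_) (sumℕ≡∑ (f ∘ suc))

colSum : ∀ {n} → Point n → Fin n → ℚ
colSum x j = ℚΣ.sum (λ i → x i j)

offDiagColSum≡colSum : ∀ {n} (x : Point n) j → x j j ≡ 0ℚ → offDiagColSum x j ≡ colSum x j
offDiagColSum≡colSum {n} x j xⱼⱼ≡0 = trans (sumℚ≡∑ offDiag) (ℚΣ.sum-cong-≗ entry)
  where
  offDiag : Fin n → ℚ
  offDiag i = if ⌊ i ≟ j ⌋ then 0ℚ else x i j
  entry : ∀ i → offDiag i ≡ x i j
  entry i with i ≟ j
  ... | yes refl = sym xⱼⱼ≡0
  ... | no _ = refl

fromℤ : ℤ → ℚ
fromℤ z = mkℚ z 0 (Coprimality.sym (Coprimality.1-coprimeTo _))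

z/1≡fromℤ : ∀ z → z / 1 ≡ fromℤ z
z/1≡fromℤ z = ℚP.↥p/↧p≡p (fromℤ z)

fromℤ-+ : ∀ a b → fromℤ (a ℤ.+ b) ≡ fromℤ a ℚ.+ fromℤ b
fromℤ-+ a b = ℚP.toℚᵘ-injective (ℚᵘP.≃-sym (ℚᵘP.≃-trans (ℚP.toℚᵘ-homo-+ (fromℤ a) (fromℤ b))
  (ℚᵘ.*≡* (cong₂ ℤ._*_ (cong₂ ℤ._+_ (ℤP.*-identityʳ a) (ℤP.*-identityʳ b)) refl))))

fromℤ-neg : ∀ a → fromℤ (ℤ.- a) ≡ ℚ.- fromℤ a
fromℤ-neg a = ℚP.toℚᵘ-injective (ℚᵘP.≃-sym (ℚᵘP.≃-trans (ℚP.toℚᵘ-homo‿- (fromℤ a)) (ℚᵘ.*≡* refl)))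

ℕ→ℚ-+ : ∀ a b → ℕ→ℚ (a ℕ.+ b) ≡ ℕ→ℚ a ℚ.+ ℕ→ℚ b
ℕ→ℚ-+ a b = begin
  + (a ℕ.+ b) / 1             ≡⟨ z/1≡fromℤ (+ (a ℕ.+ b)) ⟩
  fromℤ (+ a ℤ.+ + b)         ≡⟨ fromℤ-+ (+ a) (+ b) ⟩
  fromℤ (+ a) ℚ.+ fromℤ (+ b) ≡⟨ cong₂ ℚ._+_ (z/1≡fromℤ (+ a)) (z/1≡fromℤ (+ b)) ⟨
  ℕ→ℚ a ℚ.+ ℕ→ℚ b             ∎
  where open ≡-Reasoning

ℕ→ℚ-injective : ∀ {a b} → ℕ→ℚ a ≡ ℕ→ℚ b → a ≡ b
ℕ→ℚ-injective {a} {b} eq = ℤP.+-injective (cong ℚ.numerator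
  (trans (sym (z/1≡fromℤ (+ a))) (trans eq (z/1≡fromℤ (+ b)))))

ℕ→ℚ-sum : ∀ {n} (f : Fin n → ℕ) → ℚΣ.sum (λ i → ℕ→ℚ (f i)) ≡ ℕ→ℚ (ℕΣ.sum f)
ℕ→ℚ-sum {zero} f = refl
ℕ→ℚ-sum {suc n} f = trans (cong (ℕ→ℚ (f zero) ℚ.+_) (ℕ→ℚ-sum (f ∘ suc))) (sym (ℕ→ℚ-+ (f zero) _))

IsIntegral⇒≡fromℤ : ∀ {q} → IsIntegral q → ∃ λ z → q ≡ fromℤ z
IsIntegral⇒≡fromℤ (z , q≡z/1) = z , trans q≡z/1 (z/1≡fromℤ z)

fromℤ-IsIntegral : ∀ z → IsIntegral (fromℤ z)
fromℤ-IsIntegral z = z , sym (z/1≡fromℤ z)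

IsIntegral-0 : IsIntegral 0ℚ
IsIntegral-0 = + 0 , refl

IsIntegral-1 : IsIntegral 1ℚ
IsIntegral-1 = + 1 , refl

IsIntegral-ℕ→ℚ : ∀ k → IsIntegral (ℕ→ℚ k)
IsIntegral-ℕ→ℚ k = + k , refl

IsIntegral-+ : ∀ {p q} → IsIntegral p → IsIntegral q → IsIntegral (p ℚ.+ q)
IsIntegral-+ ip iq with IsIntegral⇒≡fromℤ ip | IsIntegral⇒≡fromℤ iq
... | a , refl | b , refl = subst IsIntegral (fromℤ-+ a b) (fromℤ-IsIntegral (a ℤ.+ b))

IsIntegral-neg : ∀ {p} → IsIntegral p → IsIntegral (ℚ.- p)
IsIntegral-neg ip with IsIntegral⇒≡fromℤ ip
... | a , refl = subst IsIntegral (fromℤ-neg a) (fromℤ-IsIntegral (ℤ.- a))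

IsIntegral-sum : ∀ {n} (f : Fin n → ℚ) → (∀ i → IsIntegral (f i)) → IsIntegral (ℚΣ.sum f)
IsIntegral-sum {zero} f _ = IsIntegral-0
IsIntegral-sum {suc n} f int = IsIntegral-+ (int zero) (IsIntegral-sum (f ∘ suc) (int ∘ suc))

IsIntegral-cancelʳ : ∀ {p q r} → p ℚ.+ q ≡ r → IsIntegral q → IsIntegral r → IsIntegral p
IsIntegral-cancelʳ {p} {q} {r} p+q≡r iq ir = subst IsIntegral r-q≡p (IsIntegral-+ ir (IsIntegral-neg iq))
  where
  r-q≡p : r ℚ.- q ≡ p
  r-q≡p = trans (cong (ℚ._- q) (sym p+q≡r)) (solve 2 (λ p q → (p :+ q) :- q := p) refl p q)

IsIntegral∩[0,1] : ∀ {q} → IsIntegral q → 0ℚ ℚ.≤ q → q ℚ.≤ 1ℚ → q ≡ 0ℚ ⊎ q ≡ 1ℚ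
IsIntegral∩[0,1] iq with IsIntegral⇒≡fromℤ iq
... | + 0 , refl = λ _ _ → inj₁ refl
... | + 1 , refl = λ _ _ → inj₂ refl
... | +[1+ suc k ] , refl = λ { _ (ℚ.*≤* (ℤ.+≤+ (ℕ.s≤s ()))) }
... | -[1+ k ] , refl = λ { (ℚ.*≤* ()) _ }

IsIntegral∩⟨0,2⟩ : ∀ {q} → IsIntegral q → 0ℚ ℚ.< q → q ℚ.< 1ℚ ℚ.+ 1ℚ → q ≡ 1ℚ
IsIntegral∩⟨0,2⟩ iq with IsIntegral⇒≡fromℤ iq
... | + 0 , refl = λ { (ℚ.*<* (ℤ.+<+ ())) _ }
... | + 1 , refl = λ _ _ → refl
... | +[1+ suc k ] , refl = λ { _ (ℚ.*<* (ℤ.+<+ (ℕ.s≤s (ℕ.s≤s ())))) }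
... | -[1+ k ] , refl = λ { (ℚ.*<* ()) _ }

≤-from-gap : ∀ {p q} r → q ℚ.- p ≡ r → 0ℚ ℚ.≤ r → p ℚ.≤ q
≤-from-gap {p} {q} r q-p≡r 0≤r = subst₂ ℚ._≤_ (ℚP.+-identityˡ p) q-p+p≡q (ℚP.+-monoˡ-≤ p (subst (0ℚ ℚ.≤_) (sym q-p≡r) 0≤r))
  where
  q-p+p≡q : (q ℚ.- p) ℚ.+ p ≡ q
  q-p+p≡q = solve 2 (λ p q → (q :- p) :+ p := q) refl p q

p≤q⇒0≤q-p : ∀ {p q} → p ℚ.≤ q → 0ℚ ℚ.≤ q ℚ.- p
p≤q⇒0≤q-p {p} {q} p≤q = subst (ℚ._≤ q ℚ.- p) (ℚP.+-inverseʳ p) (ℚP.+-monoˡ-≤ (ℚ.- p) p≤q)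

p<q⇒0<q-p : ∀ {p q} → p ℚ.< q → 0ℚ ℚ.< q ℚ.- p
p<q⇒0<q-p {p} {q} p<q = subst (ℚ._< q ℚ.- p) (ℚP.+-inverseʳ p) (ℚP.+-monoˡ-< (ℚ.- p) p<q)

0≤p*q : ∀ {p q} → 0ℚ ℚ.≤ p → 0ℚ ℚ.≤ q → 0ℚ ℚ.≤ p ℚ.* q
0≤p*q {p} {q} 0≤p 0≤q = subst (ℚ._≤ p ℚ.* q) (ℚP.*-zeroʳ p) (ℚP.*-monoˡ-≤-nonNeg p {{ℚ.nonNegative 0≤p}} 0≤q)

0<p*q : ∀ {p q} → 0ℚ ℚ.< p → 0ℚ ℚ.< q → 0ℚ ℚ.< p ℚ.* q
0<p*q {p} {q} 0<p 0<q = subst (ℚ._< p ℚ.* q) (ℚP.*-zeroʳ p) (ℚP.*-monoʳ-<-pos p {{ℚ.positive 0<p}} 0<q)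

≤∧≢⇒< : ∀ {p q} → p ℚ.≤ q → p ≢ q → p ℚ.< q
≤∧≢⇒< {p} {q} p≤q p≢q with ℚP.<-cmp p q
... | tri< p<q _ _ = p<q
... | tri≈ _ p≡q _ = ⊥-elim (p≢q p≡q)
... | tri> _ _ p>q = ⊥-elim (ℚP.<-irrefl refl (ℚP.≤-<-trans p≤q p>q))

0<½ : 0ℚ ℚ.< ½
0<½ = ℚ.*<* (ℤ.+<+ (ℕ.s≤s ℕ.z≤n))

½<1 : ½ ℚ.< 1ℚ
½<1 = ℚ.*<* (ℤ.+<+ (ℕ.s≤s (ℕ.s≤s ℕ.z≤n)))

0<1 : 0ℚ ℚ.< 1ℚ
0<1 = ℚ.*<* (ℤ.+<+ (ℕ.s≤s ℕ.z≤n))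

*-cancelˡ-pos-zero : ∀ {ε y} → 0ℚ ℚ.< ε → ε ℚ.* y ≡ 0ℚ → y ≡ 0ℚ
*-cancelˡ-pos-zero {ε} {y} 0<ε εy≡0 = begin
  y                       ≡⟨ ℚP.*-identityˡ y ⟨
  1ℚ ℚ.* y                ≡⟨ cong (ℚ._* y) (ℚP.*-inverseˡ ε) ⟨
  (1/ε ℚ.* ε) ℚ.* y       ≡⟨ ℚP.*-assoc 1/ε ε y ⟩
  1/ε ℚ.* (ε ℚ.* y)       ≡⟨ cong (1/ε ℚ.*_) εy≡0 ⟩
  1/ε ℚ.* 0ℚ              ≡⟨ ℚP.*-zeroʳ 1/ε ⟩
  0ℚ                      ∎
  where
  open ≡-Reasoning
  instance _ = ℚP.pos⇒nonZero ε {{ℚ.positive 0<ε}}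
  1/ε : ℚ
  1/ε = ℚ.1/ ε

x≡½*[x+x] : ∀ x → x ≡ ½ ℚ.* (x ℚ.+ x)
x≡½*[x+x] = solve 1 (λ x → x := con ½ :* (x :+ x)) refl

convex-combination-zero : ∀ {t a b} → 0ℚ ℚ.< t → t ℚ.< 1ℚ → 0ℚ ℚ.≤ a → 0ℚ ℚ.≤ b →
                          t ℚ.* a ℚ.+ (1ℚ ℚ.- t) ℚ.* b ≡ 0ℚ → a ≡ 0ℚ × b ≡ 0ℚ
convex-combination-zero {t} {a} {b} 0<t t<1 0≤a 0≤b sum≡0 =
  *-cancelˡ-pos-zero 0<t (summand-zero ta tb 0≤ta 0≤tb sum≡0) ,
  *-cancelˡ-pos-zero (p<q⇒0<q-p t<1) (summand-zero tb ta 0≤tb 0≤ta (trans (ℚP.+-comm tb ta) sum≡0))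
  where
  ta tb : ℚ
  ta = t ℚ.* a
  tb = (1ℚ ℚ.- t) ℚ.* b
  0≤ta : 0ℚ ℚ.≤ ta
  0≤ta = 0≤p*q (ℚP.<⇒≤ 0<t) 0≤a
  0≤tb : 0ℚ ℚ.≤ tb
  0≤tb = 0≤p*q (ℚP.<⇒≤ (p<q⇒0<q-p t<1)) 0≤b
  summand-zero : ∀ p q → 0ℚ ℚ.≤ p → 0ℚ ℚ.≤ q → p ℚ.+ q ≡ 0ℚ → p ≡ 0ℚ
  summand-zero p q 0≤p 0≤q p+q≡0 = ℚP.≤-antisym
    (subst (p ℚ.≤_) p+q≡0 (≤-from-gap q (solve 2 (λ p q → (p :+ q) :- p := q) refl p q) 0≤q)) 0≤p

uniform-lower-bound : ∀ {m} (f : Fin m → ℚ) → (∀ i → 0ℚ ℚ.< f i) →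
                      ∃ λ ε → 0ℚ ℚ.< ε × (∀ i → ε ℚ.≤ f i)
uniform-lower-bound {zero} f _ = 1ℚ , 0<1 , λ ()
uniform-lower-bound {suc m} f pos with uniform-lower-bound (f ∘ suc) (pos ∘ suc)
... | ε , 0<ε , ε≤ with ℚP.≤-total (f zero) ε
...   | inj₁ f₀≤ε = f zero , pos zero , λ { zero → ℚP.≤-refl ; (suc i) → ℚP.≤-trans f₀≤ε (ε≤ i) }
...   | inj₂ ε≤f₀ = ε , 0<ε , λ { zero → ε≤f₀ ; (suc i) → ε≤ i }

uniform-lower-bound₂ : ∀ {m k} (f : Fin m → Fin k → ℚ) → (∀ i j → 0ℚ ℚ.< f i j) →
                       ∃ λ ε → 0ℚ ℚ.< ε × (∀ i j → ε ℚ.≤ f i j)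
uniform-lower-bound₂ f pos =
  let ε , 0<ε , ε≤ = uniform-lower-bound (proj₁ ∘ row) (proj₁ ∘ proj₂ ∘ row)
  in ε , 0<ε , λ i j → ℚP.≤-trans (ε≤ i) (proj₂ (proj₂ (row i)) j)
  where
  row : ∀ i → ∃ λ ε → 0ℚ ℚ.< ε × (∀ j → ε ℚ.≤ f i j)
  row i = uniform-lower-bound (f i) (pos i)

∣p∣-bounds : ∀ p → p ℚ.≤ ℚ.∣ p ∣ × ℚ.- p ℚ.≤ ℚ.∣ p ∣
∣p∣-bounds p with ℚP.∣p∣≡p∨∣p∣≡-p p
... | inj₁ ∣p∣≡p = ℚP.≤-reflexive (sym ∣p∣≡p) ,
  ≤-from-gap (p ℚ.+ p) (trans (cong (ℚ._- ℚ.- p) ∣p∣≡p) (solve 1 (λ p → p :- (:- p) := p :+ p) refl p))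
    (subst (λ q → 0ℚ ℚ.≤ q ℚ.+ q) ∣p∣≡p (ℚP.+-mono-≤ (ℚP.0≤∣p∣ p) (ℚP.0≤∣p∣ p)))
... | inj₂ ∣p∣≡-p = ≤-from-gap (ℚ.- p ℚ.- p) (cong (ℚ._- p) ∣p∣≡-p)
    (subst (λ q → 0ℚ ℚ.≤ q ℚ.+ q) ∣p∣≡-p (ℚP.+-mono-≤ (ℚP.0≤∣p∣ p) (ℚP.0≤∣p∣ p))) ,
  ℚP.≤-reflexive (sym ∣p∣≡-p)

1+∣p∣ : ℚ → ℚ
1+∣p∣ p = 1ℚ ℚ.+ ℚ.∣ p ∣

0<1+∣p∣ : ∀ p → 0ℚ ℚ.< 1+∣p∣ p
0<1+∣p∣ p = ℚP.<-≤-trans 0<1 (≤-from-gap ℚ.∣ p ∣ (solve 1 (λ a → (con 1ℚ :+ a) :- con 1ℚ := a) refl ℚ.∣ p ∣) (ℚP.0≤∣p∣ p))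

1/[1+∣p∣] : ℚ → ℚ
1/[1+∣p∣] p = ℚ.1/_ (1+∣p∣ p) {{ℚP.pos⇒nonZero (1+∣p∣ p) {{ℚ.positive (0<1+∣p∣ p)}}}}

0<1/[1+∣p∣] : ∀ p → 0ℚ ℚ.< 1/[1+∣p∣] p
0<1/[1+∣p∣] p = ℚP.positive⁻¹ (1/[1+∣p∣] p) {{ℚP.1/pos⇒pos (1+∣p∣ p) {{ℚ.positive (0<1+∣p∣ p)}}}}

1/[1+∣p∣]*[1+∣p∣]≡1 : ∀ p → 1/[1+∣p∣] p ℚ.* 1+∣p∣ p ≡ 1ℚ
1/[1+∣p∣]*[1+∣p∣]≡1 p = ℚP.*-inverseˡ (1+∣p∣ p) {{ℚP.pos⇒nonZero (1+∣p∣ p) {{ℚ.positive (0<1+∣p∣ p)}}}}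

-- For 0 ≤ s ≤ safeStep x y we get |s y| ≤ x (1 - x) ≤ min (x, 1 - x).
safeStep : ℚ → ℚ → ℚ
safeStep x y = (x ℚ.* (1ℚ ℚ.- x)) ℚ.* 1/[1+∣p∣] y

safeStep-pos : ∀ {x} y → 0ℚ ℚ.< x → x ℚ.< 1ℚ → 0ℚ ℚ.< safeStep x y
safeStep-pos y 0<x x<1 = 0<p*q (0<p*q 0<x (p<q⇒0<q-p x<1)) (0<1/[1+∣p∣] y)

step-within-[0,1] : ∀ {x s} y → 0ℚ ℚ.< x → x ℚ.< 1ℚ → 0ℚ ℚ.≤ s → s ℚ.≤ safeStep x y →
  (0ℚ ℚ.≤ x ℚ.+ s ℚ.* y × x ℚ.+ s ℚ.* y ℚ.≤ 1ℚ) ×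
  (0ℚ ℚ.≤ x ℚ.+ ℚ.- s ℚ.* y × x ℚ.+ ℚ.- s ℚ.* y ℚ.≤ 1ℚ)
step-within-[0,1] {x} {s} y 0<x x<1 0≤s s≤safe =
  within (s ℚ.* y) sy≤m -sy≤m ,
  within (ℚ.- s ℚ.* y) (subst (ℚ._≤ m) -[sy]≡-s*y -sy≤m)
                       (subst (ℚ._≤ m) (solve 2 (λ s y → s :* y := :- ((:- s) :* y)) refl s y) sy≤m)
  where
  m : ℚ
  m = x ℚ.* (1ℚ ℚ.- x)
  0≤x : 0ℚ ℚ.≤ x
  0≤x = ℚP.<⇒≤ 0<x
  0≤1-x : 0ℚ ℚ.≤ 1ℚ ℚ.- x
  0≤1-x = ℚP.<⇒≤ (p<q⇒0<q-p x<1)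
  m≤x : m ℚ.≤ x
  m≤x = ≤-from-gap (x ℚ.* x) (solve 1 (λ x → x :- x :* (con 1ℚ :- x) := x :* x) refl x) (0≤p*q 0≤x 0≤x)
  m≤1-x : m ℚ.≤ 1ℚ ℚ.- x
  m≤1-x = ≤-from-gap ((1ℚ ℚ.- x) ℚ.* (1ℚ ℚ.- x))
    (solve 1 (λ x → (con 1ℚ :- x) :- x :* (con 1ℚ :- x) := (con 1ℚ :- x) :* (con 1ℚ :- x)) refl x) (0≤p*q 0≤1-x 0≤1-x)
  s∣y∣≤m : s ℚ.* ℚ.∣ y ∣ ℚ.≤ m
  s∣y∣≤m = ℚP.≤-trans
    (≤-from-gap s (solve 2 (λ s a → s :* (con 1ℚ :+ a) :- s :* a := s) refl s ℚ.∣ y ∣) 0≤s)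
    (ℚP.≤-trans (ℚP.*-monoʳ-≤-nonNeg (1+∣p∣ y) {{ℚ.nonNegative (ℚP.<⇒≤ (0<1+∣p∣ y))}} s≤safe)
                (ℚP.≤-reflexive (trans (ℚP.*-assoc m _ _) (trans (cong (m ℚ.*_) (1/[1+∣p∣]*[1+∣p∣]≡1 y)) (ℚP.*-identityʳ m)))))
  sy≤m : s ℚ.* y ℚ.≤ m
  sy≤m = ℚP.≤-trans (ℚP.*-monoˡ-≤-nonNeg s {{ℚ.nonNegative 0≤s}} (proj₁ (∣p∣-bounds y))) s∣y∣≤m
  -[sy]≡-s*y : ℚ.- (s ℚ.* y) ≡ ℚ.- s ℚ.* y
  -[sy]≡-s*y = ℚP.neg-distribˡ-* s y
  -sy≤m : ℚ.- (s ℚ.* y) ℚ.≤ m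
  -sy≤m = ℚP.≤-trans (ℚP.≤-reflexive (ℚP.neg-distribʳ-* s y))
    (ℚP.≤-trans (ℚP.*-monoˡ-≤-nonNeg s {{ℚ.nonNegative 0≤s}} (proj₂ (∣p∣-bounds y))) s∣y∣≤m)
  within : ∀ z → z ℚ.≤ m → ℚ.- z ℚ.≤ m → 0ℚ ℚ.≤ x ℚ.+ z × x ℚ.+ z ℚ.≤ 1ℚ
  within z z≤m -z≤m =
    ≤-from-gap ((x ℚ.- m) ℚ.+ (m ℚ.- ℚ.- z)) (solve 3 (λ x z m → (x :+ z) :- con 0ℚ := (x :- m) :+ (m :- (:- z))) refl x z m)
      (ℚP.+-mono-≤ (p≤q⇒0≤q-p m≤x) (p≤q⇒0≤q-p -z≤m)) ,
    ≤-from-gap ((1ℚ ℚ.- x ℚ.- m) ℚ.+ (m ℚ.- z)) (solve 3 (λ x z m → con 1ℚ :- (x :+ z) := (con 1ℚ :- x :- m) :+ (m :- z)) refl x z m)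
      (ℚP.+-mono-≤ (p≤q⇒0≤q-p m≤1-x) (p≤q⇒0≤q-p z≤m))

parity≡1ℙ⇒%2≡1 : ∀ k → parity k ≡ 1ℙ → k ℕ.% 2 ≡ 1
parity≡1ℙ⇒%2≡1 1 _ = refl
parity≡1ℙ⇒%2≡1 (suc (suc k)) p = parity≡1ℙ⇒%2≡1 k p

%2≡1⇒parity≡1ℙ : ∀ k → k ℕ.% 2 ≡ 1 → parity k ≡ 1ℙ
%2≡1⇒parity≡1ℙ 1 _ = refl
%2≡1⇒parity≡1ℙ (suc (suc k)) p = %2≡1⇒parity≡1ℙ k p

parity≡0ℙ⇒%2≡0 : ∀ k → parity k ≡ 0ℙ → k ℕ.% 2 ≡ 0
parity≡0ℙ⇒%2≡0 0 _ = refl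
parity≡0ℙ⇒%2≡0 (suc (suc k)) p = parity≡0ℙ⇒%2≡0 k p

parity-suc : ∀ k → parity (suc k) ≡ parity k ⁻¹
parity-suc k = trans (sym (ℙP.⁻¹-involutive _)) (cong _⁻¹ (ℙP.suc-homo-⁻¹ k))

parity-suc≡0ℙ : ∀ k → parity (suc k) ≡ 0ℙ → parity k ≡ 1ℙ
parity-suc≡0ℙ k eq = trans (sym (ℙP.suc-homo-⁻¹ k)) (cong _⁻¹ eq)

parity-+-suc≡1ℙ : ∀ a b → parity (a + b) ≡ 0ℙ → parity (a + suc b) ≡ 1ℙ
parity-+-suc≡1ℙ a b eq = trans (cong parity (ℕP.+-suc a b)) (trans (parity-suc (a + b)) (cong _⁻¹ eq))

parity-cancel : ∀ a b c → parity (a + b) ≡ 1ℙ → parity (a + c) ≡ 1ℙ → parity (b + c) ≡ 0ℙ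
parity-cancel a b c ab ac
  rewrite ℙP.+-homo-+ a b | ℙP.+-homo-+ a c | ℙP.+-homo-+ b c = table (parity a) (parity b) (parity c) ab ac
  where
  table : ∀ p q r → p ℙ.+ q ≡ 1ℙ → p ℙ.+ r ≡ 1ℙ → q ℙ.+ r ≡ 0ℙ
  table 0ℙ 1ℙ 1ℙ _ _ = refl
  table 1ℙ 0ℙ 0ℙ _ _ = refl
  table 0ℙ 0ℙ _ () _
  table 1ℙ 1ℙ _ () _
  table 0ℙ 1ℙ 0ℙ _ ()
  table 1ℙ 0ℙ 1ℙ _ ()

parity-t+[d+t] : ∀ t d → parity (t + (d + t)) ≡ parity d
parity-t+[d+t] t d = begin
  parity (t + (d + t))            ≡⟨ cong parity (trans (ℕP.+-comm t (d + t)) (ℕP.+-assoc d t t)) ⟩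
  parity (d + (t + t))            ≡⟨ ℙP.+-homo-+ d (t + t) ⟩
  parity d ℙ.+ parity (t + t)     ≡⟨ cong (parity d ℙ.+_) (trans (ℙP.+-homo-+ t t) (ℙP.p+p≡0ℙ (parity t))) ⟩
  parity d ℙ.+ 0ℙ                 ≡⟨ ℙP.+-identityʳ (parity d) ⟩
  parity d                        ∎
  where open ≡-Reasoning

next : ∀ {L} → Fin L → Fin L
next {suc L} m with suc (toℕ m) ℕ.<? suc L
... | yes m+1<L = Fin.fromℕ< m+1<L
... | no _ = zero

prev : ∀ {L} → Fin L → Fin L
prev {suc L} zero = Fin.fromℕ L
prev {suc L} (suc m) = Fin.inject₁ m

CycSucc-next : ∀ {L} (m : Fin L) → CycSucc m (next m)
CycSucc-next {suc L} m with suc (toℕ m) ℕ.<? suc L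
... | yes m+1<L = inj₁ (sym (FinP.toℕ-fromℕ< m+1<L))
... | no m+1≮L = inj₂ (ℕP.≤-antisym (FinP.toℕ<n m) (ℕP.≮⇒≥ m+1≮L) , refl)

CycSucc-prev : ∀ {L} (m : Fin L) → CycSucc (prev m) m
CycSucc-prev {suc L} zero = inj₂ (cong suc (FinP.toℕ-fromℕ L) , refl)
CycSucc-prev {suc L} (suc m) = inj₁ (cong suc (FinP.toℕ-inject₁ m))

CycSucc-functional : ∀ {L} {m a b : Fin L} → CycSucc m a → CycSucc m b → a ≡ b
CycSucc-functional (inj₁ m+1≡a) (inj₁ m+1≡b) = FinP.toℕ-injective (trans (sym m+1≡a) m+1≡b)
CycSucc-functional {a = a} (inj₁ m+1≡a) (inj₂ (m+1≡L , _)) =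
  ⊥-elim (ℕP.<-irrefl (trans (sym m+1≡a) m+1≡L) (FinP.toℕ<n a))
CycSucc-functional {b = b} (inj₂ (m+1≡L , _)) (inj₁ m+1≡b) =
  ⊥-elim (ℕP.<-irrefl (trans (sym m+1≡b) m+1≡L) (FinP.toℕ<n b))
CycSucc-functional (inj₂ (_ , a≡0)) (inj₂ (_ , b≡0)) = FinP.toℕ-injective (trans a≡0 (sym b≡0))

CycSucc-injective : ∀ {L} {m a b : Fin L} → CycSucc a m → CycSucc b m → a ≡ b
CycSucc-injective (inj₁ a+1≡m) (inj₁ b+1≡m) = FinP.toℕ-injective (ℕP.suc-injective (trans a+1≡m (sym b+1≡m)))
CycSucc-injective (inj₁ a+1≡m) (inj₂ (_ , m≡0)) with trans a+1≡m m≡0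
... | ()
CycSucc-injective (inj₂ (_ , m≡0)) (inj₁ b+1≡m) with trans b+1≡m m≡0
... | ()
CycSucc-injective (inj₂ (a+1≡L , _)) (inj₂ (b+1≡L , _)) = FinP.toℕ-injective (ℕP.suc-injective (trans a+1≡L (sym b+1≡L)))

CycSucc-asym : ∀ {L} → 3 ℕ.≤ L → ∀ {m k : Fin L} → CycSucc m k → CycSucc k m → ⊥
CycSucc-asym 3≤L (inj₁ m+1≡k) (inj₁ k+1≡m) =
  ℕP.<-irrefl (sym (trans (cong suc m+1≡k) k+1≡m)) (ℕP.m<n⇒m<1+n (ℕP.n<1+n _))
CycSucc-asym 3≤L (inj₁ m+1≡k) (inj₂ (k+1≡L , m≡0)) =
  ℕP.<⇒≱ 3≤L (ℕP.≤-reflexive (trans (sym k+1≡L) (cong suc (trans (sym m+1≡k) (cong suc m≡0)))))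
CycSucc-asym 3≤L (inj₂ (m+1≡L , k≡0)) (inj₁ k+1≡m) =
  ℕP.<⇒≱ 3≤L (ℕP.≤-reflexive (trans (sym m+1≡L) (cong suc (trans (sym k+1≡m) (cong suc k≡0)))))
CycSucc-asym 3≤L (inj₂ (_ , k≡0)) (inj₂ (k+1≡L , _)) =
  ℕP.<⇒≱ 3≤L (ℕP.≤-trans (ℕP.≤-reflexive (trans (sym k+1≡L) (cong suc k≡0))) (ℕP.n≤1+n 1))

next≢prev : ∀ {L} → 3 ℕ.≤ L → (m : Fin L) → next m ≢ prev m
next≢prev 3≤L m next≡prev =
  CycSucc-asym 3≤L (CycSucc-next m) (subst (λ k → CycSucc k m) (sym next≡prev) (CycSucc-prev m))

orbit : ∀ {L} → ℕ → Fin (suc L)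
orbit zero = zero
orbit (suc k) = next (orbit k)

toℕ-orbit : ∀ {L} k → k ℕ.< suc L → toℕ (orbit {L} k) ≡ k
toℕ-orbit zero _ = refl
toℕ-orbit {L} (suc k) k+1<L+1 with CycSucc-next (orbit {L} k)
... | inj₁ eq = trans (sym eq) (cong suc (toℕ-orbit k (ℕP.<-trans (ℕP.n<1+n k) k+1<L+1)))
... | inj₂ (eq , _) =
  ⊥-elim (ℕP.<-irrefl (trans (cong suc (sym (toℕ-orbit k (ℕP.<-trans (ℕP.n<1+n k) k+1<L+1)))) eq) k+1<L+1)

orbit-toℕ : ∀ {L} (m : Fin (suc L)) → orbit (toℕ m) ≡ m
orbit-toℕ m = FinP.toℕ-injective (toℕ-orbit (toℕ m) (FinP.toℕ<n m))

orbit-period : ∀ {L} → orbit {L} (suc L) ≡ zero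
orbit-period {L} = CycSucc-functional (CycSucc-next (orbit {L} L)) (inj₂ (cong suc (toℕ-orbit L ℕP.≤-refl) , refl))

-- Consecutive terms summing to c force period 2; an odd period then forces every term to be c/2.
alternating-odd-period : (g : ℕ → ℚ) (c : ℚ) → (∀ k → g k ℚ.+ g (suc k) ≡ c) →
                         ∀ L → parity L ≡ 1ℙ → g L ≡ g 0 → ∀ k → g k ≡ ½ ℚ.* c
alternating-odd-period g c sum≡c L odd gL≡g0 = every
  where
  successor : ∀ k → g (suc k) ≡ c ℚ.- g k
  successor k = trans (solve 2 (λ a b → b := (a :+ b) :- a) refl (g k) (g (suc k))) (cong (ℚ._- g k) (sum≡c k))
  two-periodic : ∀ k → g (suc (suc k)) ≡ g k
  two-periodic k = trans (successor (suc k)) (trans (cong (λ x → c ℚ.- x) (successor k))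
                     (solve 2 (λ c a → c :- (c :- a) := a) refl c (g k)))
  odd-terms : ∀ k → parity k ≡ 1ℙ → g k ≡ g 1
  odd-terms 1 _ = refl
  odd-terms (suc (suc k)) odd = trans (two-periodic k) (odd-terms k odd)
  first : g 0 ≡ ½ ℚ.* c
  first = trans (x≡½*[x+x] (g 0)) (cong (½ ℚ.*_) (trans (cong (g 0 ℚ.+_) (trans (sym gL≡g0) (odd-terms L odd))) (sum≡c 0)))
  every : ∀ k → g k ≡ ½ ℚ.* c
  every zero = first
  every (suc k) = trans (successor k) (trans (cong (λ x → c ℚ.- x) (every k))
                    (solve 1 (λ c → c :- con ½ :* c := con ½ :* c) refl c))

alternating-odd-cycle : ∀ {L} → parity L ≡ 1ℙ → (f : Fin L → ℚ) (c : ℚ) →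
                        (∀ m → f m ℚ.+ f (next m) ≡ c) → ∀ m → f m ≡ ½ ℚ.* c
alternating-odd-cycle {suc L} odd f c sum≡c m =
  trans (cong f (sym (orbit-toℕ m)))
        (alternating-odd-period (f ∘ orbit) c (sum≡c ∘ orbit) (suc L) odd (cong f orbit-period) (toℕ m))

sum-ones : ∀ L → ℕΣ.sum (λ (_ : Fin L) → 1) ≡ L
sum-ones zero = refl
sum-ones (suc L) = cong suc (sum-ones L)

parity-sum-odd : ∀ {k} (f : Fin k → ℕ) → (∀ i → parity (f i) ≡ 1ℙ) → parity (ℕΣ.sum f) ≡ parity k
parity-sum-odd {zero} f _ = refl
parity-sum-odd {suc k} f odd = begin
  parity (f zero + ℕΣ.sum (f ∘ suc))          ≡⟨ ℙP.+-homo-+ (f zero) _ ⟩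
  parity (f zero) ℙ.+ parity (ℕΣ.sum (f ∘ suc)) ≡⟨ cong₂ ℙ._+_ (odd zero) (parity-sum-odd (f ∘ suc) (odd ∘ suc)) ⟩
  parity k ⁻¹                                 ≡⟨ parity-suc k ⟨
  parity (suc k)                              ∎
  where open ≡-Reasoning

handshake : ∀ {n} (A : Fin n → Fin n → ℕ) → (∀ i j → A i j ≡ A j i) → (∀ i → A i i ≡ 0) →
            parity (ℕΣ.sum (λ j → ℕΣ.sum (λ i → A i j))) ≡ 0ℙ
handshake {zero} A _ _ = refl
handshake {suc n} A A-sym A-diag = begin
  parity ((A zero zero + X) + ℕΣ.sum (λ j → A zero (suc j) + S j))
    ≡⟨ cong parity (cong₂ _+_ (cong (_+ X) (A-diag zero)) first-row) ⟩
  parity (X + (X + ℕΣ.sum S))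
    ≡⟨ trans (ℙP.+-homo-+ X _) (cong (parity X ℙ.+_) (ℙP.+-homo-+ X _)) ⟩
  parity X ℙ.+ (parity X ℙ.+ parity (ℕΣ.sum S))
    ≡⟨ trans (sym (ℙP.+-assoc (parity X) (parity X) (parity (ℕΣ.sum S))))
             (cong (ℙ._+ parity (ℕΣ.sum S)) (ℙP.p+p≡0ℙ (parity X))) ⟩
  parity (ℕΣ.sum S)
    ≡⟨ handshake (λ i j → A (suc i) (suc j)) (λ i j → A-sym (suc i) (suc j)) (A-diag ∘ suc) ⟩
  0ℙ
    ∎
  where
  open ≡-Reasoning
  X : ℕ
  X = ℕΣ.sum (λ i → A (suc i) zero)
  S : Fin n → ℕ
  S j = ℕΣ.sum (λ i → A (suc i) (suc j))
  first-row : ℕΣ.sum (λ j → A zero (suc j) + S j) ≡ X + ℕΣ.sum S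
  first-row = trans (ℕΣ.∑-distrib-+ (λ j → A zero (suc j)) S) (cong (_+ ℕΣ.sum S) (ℕΣ.sum-cong-≗ (λ j → A-sym zero (suc j))))

module _ {A : Set} where

  lastOf : A → List A → A
  lastOf a [] = a
  lastOf a (b ∷ bs) = lastOf b bs

  lastOf-∷ʳ : ∀ a xs (y : A) → lastOf a (xs ++ [ y ]) ≡ y
  lastOf-∷ʳ a [] y = refl
  lastOf-∷ʳ a (x ∷ xs) y = lastOf-∷ʳ x xs y

  lastOf-∈ : ∀ (a : A) xs → lastOf a xs ∈ a ∷ xs
  lastOf-∈ a [] = here refl
  lastOf-∈ a (b ∷ bs) = there (lastOf-∈ b bs)

  lastOf-∷ʳ⁻ : ∀ a as xs (y : A) → a ∷ as ≡ xs ++ [ y ] → lastOf a as ≡ y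
  lastOf-∷ʳ⁻ a as [] y refl = refl
  lastOf-∷ʳ⁻ a as (x ∷ xs) y refl = lastOf-∷ʳ x xs y

  headOr : A → List A → A
  headOr a [] = a
  headOr a (b ∷ _) = b

  Unique-∷ : ∀ {x : A} {xs} → x ∉ xs → Unique xs → Unique (x ∷ xs)
  Unique-∷ x∉xs u = AllP.¬Any⇒All¬ _ x∉xs ∷ u

  Unique-++⁻ : ∀ xs {ys : List A} → Unique (xs ++ ys) →
               Unique xs × Unique ys × (∀ {z} → z ∈ xs → z ∉ ys)
  Unique-++⁻ [] u = [] , u , λ ()
  Unique-++⁻ (x ∷ xs) u with Unique-++⁻ xs (AllPairs.tail u)
  ... | uxs , uys , disjoint =
    Unique-∷ (λ x∈xs → Unique[x∷xs]⇒x∉xs u (∈-++⁺ˡ x∈xs)) uxs , uys ,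
    λ { (here refl) z∈ys → Unique[x∷xs]⇒x∉xs u (∈-++⁺ʳ xs z∈ys) ; (there z∈xs) → disjoint z∈xs }

  Unique-++⁺ : ∀ xs {ys : List A} → Unique xs → Unique ys → (∀ {z} → z ∈ xs → z ∉ ys) → Unique (xs ++ ys)
  Unique-++⁺ [] _ uys _ = uys
  Unique-++⁺ (x ∷ xs) uxs uys disjoint =
    Unique-∷ (λ x∈ → [ Unique[x∷xs]⇒x∉xs uxs , disjoint (here refl) ]′ (∈-++⁻ xs x∈))
             (Unique-++⁺ xs (AllPairs.tail uxs) uys (disjoint ∘ there))

  Unique-reverse : ∀ (xs : List A) → Unique xs → Unique (reverse xs)
  Unique-reverse [] u = u
  Unique-reverse (x ∷ xs) u = subst Unique (sym (ListP.unfold-reverse x xs))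
    (Unique-++⁺ (reverse xs) (Unique-reverse xs (AllPairs.tail u)) (Unique-∷ (λ ()) [])
      (λ { x∈ (here refl) → Unique[x∷xs]⇒x∉xs u (AnyP.reverse⁻ x∈) }))

  module _ {R : A → A → Set} where

    Linked-join : ∀ xs {y ys} → Linked R (xs ++ [ y ]) → Linked R (y ∷ ys) → Linked R (xs ++ y ∷ ys)
    Linked-join [] _ l = l
    Linked-join (x ∷ []) (r ∷ _) l = r ∷ l
    Linked-join (x ∷ x′ ∷ xs) (r ∷ l₁) l₂ = r ∷ Linked-join (x′ ∷ xs) l₁ l₂

    Linked-++⁻ˡ : ∀ xs {ys} → Linked R (xs ++ ys) → Linked R xs
    Linked-++⁻ˡ [] _ = []
    Linked-++⁻ˡ (x ∷ []) _ = [-]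
    Linked-++⁻ˡ (x ∷ x′ ∷ xs) (r ∷ l) = r ∷ Linked-++⁻ˡ (x′ ∷ xs) l

    Linked-++⁻ʳ : ∀ xs {ys} → Linked R (xs ++ ys) → Linked R ys
    Linked-++⁻ʳ [] l = l
    Linked-++⁻ʳ (x ∷ xs) l = Linked-++⁻ʳ xs (Linked.tail l)

    Linked-upTo : ∀ xs {y ys} → Linked R (xs ++ y ∷ ys) → Linked R (xs ++ [ y ])
    Linked-upTo xs {y} {ys} l = Linked-++⁻ˡ (xs ++ [ y ]) (subst (Linked R) (sym (ListP.++-assoc xs [ y ] ys)) l)

    Linked-reverse : (∀ {a b} → R a b → R b a) → ∀ xs → Linked R xs → Linked R (reverse xs)
    Linked-reverse sym-R [] l = []
    Linked-reverse sym-R (x ∷ []) l = [-]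
    Linked-reverse sym-R (x ∷ y ∷ xs) (r ∷ l) = subst (Linked R) (sym reverse-eq)
      (Linked-join (reverse xs) (subst (Linked R) (ListP.unfold-reverse y xs) (Linked-reverse sym-R (y ∷ xs) l))
                   (sym-R r ∷ [-]))
      where
      reverse-eq : reverse (x ∷ y ∷ xs) ≡ reverse xs ++ y ∷ [ x ]
      reverse-eq = trans (ListP.unfold-reverse x (y ∷ xs))
                     (trans (cong (_++ [ x ]) (ListP.unfold-reverse y xs)) (ListP.++-assoc (reverse xs) [ y ] [ x ]))

module _ {A : Set} {R : A → A → Set} where

  Linked-lookup : ∀ (xs : List A) {y} → Linked R (xs ++ [ y ]) →
                  ∀ (m m′ : Fin (length xs)) → suc (Fin.toℕ m) ≡ Fin.toℕ m′ → R (List.lookup xs m) (List.lookup xs m′)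
  Linked-lookup (x ∷ x′ ∷ xs) (r ∷ _) zero (suc zero) _ = r
  Linked-lookup (x ∷ x′ ∷ xs) (_ ∷ l) (suc m) (suc m′) eq = Linked-lookup (x′ ∷ xs) l m m′ (ℕP.suc-injective eq)
  Linked-lookup (x ∷ x′ ∷ xs) _ zero (suc (suc m′)) ()
  Linked-lookup (x ∷ xs) _ _ zero ()

  Linked-lookup-last : ∀ (xs : List A) {y} → Linked R (xs ++ [ y ]) →
                       ∀ (m : Fin (length xs)) → suc (Fin.toℕ m) ≡ length xs → R (List.lookup xs m) y
  Linked-lookup-last (x ∷ []) (r ∷ _) zero _ = r
  Linked-lookup-last (x ∷ x′ ∷ xs) (_ ∷ l) (suc m) eq = Linked-lookup-last (x′ ∷ xs) l m (ℕP.suc-injective eq)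

AllPairs-lookup : ∀ {A : Set} {R : A → A → Set} → (∀ {x y} → R x y → R y x) →
                  ∀ {xs} → AllPairs R xs → ∀ {p q} → p ≢ q → R (List.lookup xs p) (List.lookup xs q)
AllPairs-lookup R-sym (_ ∷ _) {zero} {zero} p≢q = ⊥-elim (p≢q refl)
AllPairs-lookup R-sym (x~xs ∷ _) {zero} {suc q} _ = All.lookup x~xs (∈-lookup q)
AllPairs-lookup R-sym (x~xs ∷ _) {suc p} {zero} _ = R-sym (All.lookup x~xs (∈-lookup p))
AllPairs-lookup R-sym (_ ∷ pairs) {suc p} {suc q} p≢q = AllPairs-lookup R-sym pairs (p≢q ∘ cong suc)

Unique⇒lookup-injective : ∀ {A : Set} (xs : List A) → Unique xs → ∀ {i j} → List.lookup xs i ≡ List.lookup xs j → i ≡ j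
Unique⇒lookup-injective (x ∷ xs) u {zero} {zero} _ = refl
Unique⇒lookup-injective (x ∷ xs) u {zero} {suc j} x≡ = ⊥-elim (Unique[x∷xs]⇒x∉xs u (subst (_∈ xs) (sym x≡) (∈-lookup j)))
Unique⇒lookup-injective (x ∷ xs) u {suc i} {zero} ≡x = ⊥-elim (Unique[x∷xs]⇒x∉xs u (subst (_∈ xs) ≡x (∈-lookup i)))
Unique⇒lookup-injective (x ∷ xs) u {suc i} {suc j} eq = cong suc (Unique⇒lookup-injective xs (AllPairs.tail u) eq)

Unique⇒length≤ : ∀ {n} (xs : List (Fin n)) → Unique xs → length xs ℕ.≤ n
Unique⇒length≤ {n} xs u with length xs ℕ.≤? n
... | yes ≤n = ≤n
... | no ≰n with FinP.pigeonhole (ℕP.≰⇒> ≰n) (List.lookup xs)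
...   | i , j , i<j , same = ⊥-elim (FinP.<⇒≢ i<j (Unique⇒lookup-injective xs u same))

module OddCycleStructure
  {n : ℕ} (R : Fin n → Fin n → Set)
  (R-sym : ∀ {i j} → R i j → R j i)
  (R-irrefl : ∀ {i j} → R i j → i ≢ j)
  (R-branch : ∀ {u w} → R u w → ∃ λ w′ → R u w′ × w′ ≢ w)
  -- u w v m u is a closed walk with |m| + 3 edges that passes through w only once
  (no-even-closed-walk : ∀ u w v m → Linked R (u ∷ w ∷ v ∷ m ++ [ u ]) → parity (length m) ≡ 1ℙ →
                         w ∉ v ∷ m → w ≢ u → v ≢ u → ⊥)
  where

  open import Data.List.Membership.DecPropositional (FinP._≟_ {n}) using (_∈?_)

  record RootedCycle (u : Fin n) : Set where
    constructor rootedCycle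
    field
      c₁ c₂ : Fin n
      cs : List (Fin n)
      unique : Unique (u ∷ c₁ ∷ c₂ ∷ cs)
      closed : Linked R (u ∷ c₁ ∷ c₂ ∷ cs ++ [ u ])

    others : List (Fin n)
    others = c₁ ∷ c₂ ∷ cs

    cₗ : Fin n
    cₗ = lastOf c₂ cs

  open RootedCycle

  RootedCycle-odd : ∀ {u} (C : RootedCycle u) → parity (length (cs C)) ≡ 0ℙ
  RootedCycle-odd {u} (rootedCycle c₁ c₂ cs unique closed) with parity (length cs) in eq
  ... | 0ℙ = refl
  ... | 1ℙ = ⊥-elim (no-even-closed-walk u c₁ c₂ cs closed eq (Unique[x∷xs]⇒x∉xs (AllPairs.tail unique))
                       (λ c₁≡u → Unique[x∷xs]⇒x∉xs unique (here (sym c₁≡u)))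
                       (λ c₂≡u → Unique[x∷xs]⇒x∉xs unique (there (here (sym c₂≡u)))))

  module Search (Target : Pred (Fin n) 0ℓ) (Target? : Decidable Target) (root : Fin n) (root∈Target : Target root) where

    -- A simple walk from start to head avoiding Target, stored backwards as head ∷ behind and
    -- followed by a step into root, together with a non-backtracking step head → out that lands
    -- in Target or back on the walk.
    record Trail (start : Fin n) : Set where
      constructor mkTrail
      field
        head : Fin n
        behind : List (Fin n)
        from-start : lastOf head behind ≡ start
        avoids : All (¬_ ∘ Target) (head ∷ behind)
        unique : Unique (head ∷ behind)
        linked : Linked R (head ∷ behind ++ [ root ])
        out : Fin n
        out-step : R head out
        no-backtrack : out ≢ headOr root behind
        stop : Target out ⊎ ∃₂ (λ b bs → behind ≡ b ∷ bs × out ∈ bs)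

    private
      step-back : ∀ {y} ys → Linked R (y ∷ ys ++ [ root ]) → R y (headOr root ys)
      step-back [] (r ∷ _) = r
      step-back (_ ∷ _) (r ∷ _) = r

      revisit : ∀ {x} ys → x ∈ ys → x ≢ headOr root ys → ∃₂ λ b bs → ys ≡ b ∷ bs × x ∈ bs
      revisit (b ∷ bs) (here x≡b) x≢b = ⊥-elim (x≢b x≡b)
      revisit (b ∷ bs) (there x∈bs) _ = b , bs , refl , x∈bs

      walk : ∀ fuel y ys → n ℕ.< length (y ∷ ys) + fuel → All (¬_ ∘ Target) (y ∷ ys) → Unique (y ∷ ys) →
             Linked R (y ∷ ys ++ [ root ]) → Trail (lastOf y ys)
      walk zero y ys n<len _ u _ =
        ⊥-elim (ℕP.<⇒≱ (subst (n ℕ.<_) (ℕP.+-identityʳ _) n<len) (Unique⇒length≤ (y ∷ ys) u))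
      walk (suc fuel) y ys n<len avoids u linked with R-branch (step-back ys linked)
      ... | x , r , x≢prev with Target? x
      ...   | yes hit = record { stop = inj₁ hit ; out = x ; out-step = r ; no-backtrack = x≢prev
                               ; head = y ; behind = ys ; from-start = refl ; avoids = avoids ; unique = u ; linked = linked }
      ...   | no miss with x ∈? (y ∷ ys)
      ...     | yes (here x≡y) = ⊥-elim (R-irrefl r (sym x≡y))
      ...     | yes (there x∈ys) = record { stop = inj₂ (revisit ys x∈ys x≢prev) ; out = x ; out-step = r ; no-backtrack = x≢prev
                               ; head = y ; behind = ys ; from-start = refl ; avoids = avoids ; unique = u ; linked = linked }
      ...     | no x∉ = walk fuel x (y ∷ ys) (subst (n ℕ.<_) (ℕP.+-suc (length (y ∷ ys)) fuel) n<len)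
                          (miss ∷ avoids) (Unique-∷ x∉ u) (R-sym r ∷ linked)

    trail : ∀ w → ¬ Target w → R w root → Trail w
    trail w miss r = walk n w [] (ℕP.n<1+n n) (miss ∷ []) (Unique-∷ (λ ()) []) (r ∷ [-])

    closes-at-root : ∀ {w} (t : Trail w) → Trail.out t ≡ root →
                     ∃ λ (C : RootedCycle root) → c₁ C ≡ Trail.head t × cₗ C ≡ w × All (¬_ ∘ Target) (others C)
    closes-at-root (mkTrail _ [] _ _ _ _ _ _ no-backtrack _) out≡root = ⊥-elim (no-backtrack out≡root)
    closes-at-root (mkTrail head (b ∷ bs) refl avoids unique linked _ step _ _) refl =
      rootedCycle head b bs (Unique-∷ (λ root∈ → All.lookup avoids root∈ root∈Target) unique) (R-sym step ∷ linked) ,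
      refl , refl , avoids

    record Lollipop : Set where
      field
        x : Fin n
        cycle : RootedCycle x
        stem : List (Fin n)
        stem-linked : Linked R (x ∷ stem ++ [ root ])
        stem-avoids : All (¬_ ∘ Target) (x ∷ stem)
        cycle-avoids : All (¬_ ∘ Target) (others cycle)
        stem-leaves : R x (headOr root stem)
        stem-leaves-c₁ : headOr root stem ≢ c₁ cycle
        stem-leaves-cₗ : headOr root stem ≢ cₗ cycle

    private
      off-loop : ∀ loop {a x} stem → All (¬_ ∘ Target) loop → Unique (loop ++ x ∷ stem) → a ∈ loop → a ≢ headOr root stem
      off-loop loop [] avoids _ a∈ a≡ = All.lookup avoids a∈ (subst Target (sym a≡) root∈Target)
      off-loop loop (_ ∷ _) _ u a∈ a≡ = proj₂ (proj₂ (Unique-++⁻ loop u)) a∈ (there (here a≡))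

    loops : ∀ {w} (t : Trail w) → ∃₂ (λ b bs → Trail.behind t ≡ b ∷ bs × Trail.out t ∈ bs) → Lollipop
    loops (mkTrail q _ _ avoids unique linked x step _ _) (b , bs , refl , x∈bs) with ∈-∃++ x∈bs
    ... | front , stem , refl = record
      { x = x ; cycle = rootedCycle q b front cycle-unique (R-sym step ∷ Linked-upTo loop linked′)
      ; stem = stem ; stem-linked = stem-linked ; stem-avoids = proj₂ avoids-split ; cycle-avoids = proj₁ avoids-split
      ; stem-leaves = step-back stem stem-linked
      ; stem-leaves-c₁ = λ eq → off-loop loop stem (proj₁ avoids-split) unique (here refl) (sym eq)
      ; stem-leaves-cₗ = λ eq → off-loop loop stem (proj₁ avoids-split) unique (there (lastOf-∈ b front)) (sym eq) }
      where
      loop : List (Fin n)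
      loop = q ∷ b ∷ front
      linked′ : Linked R (loop ++ x ∷ (stem ++ [ root ]))
      linked′ = subst (Linked R) (ListP.++-assoc loop (x ∷ stem) [ root ]) linked
      avoids-split : All (¬_ ∘ Target) loop × All (¬_ ∘ Target) (x ∷ stem)
      avoids-split = AllP.++⁻ loop avoids
      split : Unique loop × Unique (x ∷ stem) × (∀ {z} → z ∈ loop → z ∉ x ∷ stem)
      split = Unique-++⁻ loop unique
      cycle-unique : Unique (x ∷ loop)
      cycle-unique = Unique-∷ (λ x∈loop → proj₂ (proj₂ split) x∈loop (here refl)) (proj₁ split)
      stem-linked : Linked R (x ∷ stem ++ [ root ])
      stem-linked = Linked-++⁻ʳ loop linked′

  private
    avoided : ∀ {L ys : List (Fin n)} {a} → All (_∉ L) ys → a ∈ L → a ∉ ys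
    avoided avoids a∈L a∈ys = All.lookup avoids a∈ys a∈L

  no-even-closing-walk : ∀ u A x ys → Linked R (u ∷ A ++ [ x ]) → Linked R (x ∷ ys ++ [ u ]) →
    Unique (u ∷ A ++ [ x ]) → All (_∉ u ∷ A ++ [ x ]) ys → A ≢ [] ⊎ ys ≢ [] →
    parity (length A + length ys) ≡ 0ℙ → ⊥
  no-even-closing-walk u [] x [] _ _ _ _ nonempty _ = [ (λ ne → ne refl) , (λ ne → ne refl) ]′ nonempty
  no-even-closing-walk u [] x (v ∷ m) path back unique avoids _ even =
    no-even-closed-walk u x v m (Linked-join (u ∷ []) path back) (parity-suc≡0ℙ (length m) even)
      (avoided avoids (there (here refl))) (λ x≡u → Unique[x∷xs]⇒x∉xs unique (here (sym x≡u)))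
      (λ v≡u → All.lookup avoids (here refl) (here v≡u))
  no-even-closing-walk u (a ∷ []) x ys path back unique avoids _ even =
    no-even-closed-walk u a x ys (Linked-join (u ∷ a ∷ []) path back) (parity-suc≡0ℙ (length ys) even)
      (λ { (here a≡x) → Unique[x∷xs]⇒x∉xs (AllPairs.tail unique) (here a≡x) ; (there a∈ys) → avoided avoids (there (here refl)) a∈ys })
      (λ a≡u → Unique[x∷xs]⇒x∉xs unique (here (sym a≡u))) (λ x≡u → Unique[x∷xs]⇒x∉xs unique (there (here (sym x≡u))))
  no-even-closing-walk u (a ∷ v ∷ A) x ys path back unique avoids _ even =
    no-even-closed-walk u a v (A ++ x ∷ ys) walk
      (subst (λ k → parity k ≡ 1ℙ) (sym (ListP.length-++ A)) (parity-+-suc≡1ℙ (length A) (length ys) even))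
      a-once (λ a≡u → Unique[x∷xs]⇒x∉xs unique (here (sym a≡u))) (λ v≡u → Unique[x∷xs]⇒x∉xs unique (there (here (sym v≡u))))
    where
    walk : Linked R (u ∷ a ∷ v ∷ (A ++ x ∷ ys) ++ [ u ])
    walk = subst (λ zs → Linked R (u ∷ a ∷ v ∷ zs)) (sym (ListP.++-assoc A (x ∷ ys) [ u ]))
             (Linked-join (u ∷ a ∷ v ∷ A) path back)
    a-once : a ∉ v ∷ A ++ x ∷ ys
    a-once a∈ with ∈-++⁻ (v ∷ A ++ [ x ]) (subst (a ∈_) (sym (ListP.++-assoc (v ∷ A) [ x ] ys)) a∈)
    ... | inj₁ a∈path = Unique[x∷xs]⇒x∉xs (AllPairs.tail unique) a∈path
    ... | inj₂ a∈ys = avoided avoids (there (here refl)) a∈ys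

  -- The path and the two arcs of C from u to x form two cycles; as C is odd, one of them is even.
  no-path-into-cycle : ∀ {u} (C : RootedCycle u) {x} → x ∈ others C → ∀ ys → Linked R (x ∷ ys ++ [ u ]) →
    All (_∉ u ∷ others C) ys → ys ≢ [] ⊎ (x ≢ c₁ C × x ≢ cₗ C) → ⊥
  no-path-into-cycle {u} C@(rootedCycle c₁ c₂ cs unique closed) {x} x∈ ys back avoids nondegenerate
    with A , B , split ← ∈-∃++ x∈ = orient (parity (length A + length ys)) refl
    where
    closed′ : Linked R ((u ∷ A) ++ x ∷ (B ++ [ u ]))
    closed′ = subst (λ zs → Linked R (u ∷ zs)) (trans (cong (_++ [ u ]) split) (ListP.++-assoc A (x ∷ B) [ u ])) closed
    unique′ : Unique (u ∷ A ++ x ∷ B)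
    unique′ = subst (λ zs → Unique (u ∷ zs)) split unique
    u-fresh : u ∉ A ++ x ∷ B
    u-fresh = Unique[x∷xs]⇒x∉xs unique′
    cycle-odd : parity (length A + length B) ≡ 1ℙ
    cycle-odd = parity-suc≡0ℙ (length A + length B) (trans (cong parity (sym (ℕP.+-suc (length A) (length B))))
                  (trans (cong parity (sym (ListP.length-++ A))) (trans (cong (parity ∘ length) (sym split)) (RootedCycle-odd C))))
    around : ∀ P → Linked R (u ∷ P ++ [ x ]) → Unique (u ∷ P ++ [ x ]) → (∀ {z} → z ∈ P ++ [ x ] → z ∈ A ⊎ z ∈ x ∷ B) →
             P ≢ [] ⊎ ys ≢ [] → parity (length P + length ys) ≡ 0ℙ → ⊥
    around P path path-unique on-cycle = no-even-closing-walk u P x ys path back path-unique (All.map avoid avoids)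
      where
      avoid : ∀ {z} → z ∉ u ∷ c₁ ∷ c₂ ∷ cs → z ∉ u ∷ P ++ [ x ]
      avoid z∉ (here z≡u) = z∉ (here z≡u)
      avoid z∉ (there z∈) = z∉ (there (subst (_ ∈_) (sym split) ([ ∈-++⁺ˡ , ∈-++⁺ʳ A ]′ (on-cycle z∈))))

    forward : parity (length A + length ys) ≡ 0ℙ → ⊥
    forward = around A (Linked-upTo (u ∷ A) closed′) forward-unique on-cycle forward-nondegenerate
      where
      forward-unique : Unique (u ∷ A ++ [ x ])
      forward-unique = Unique-∷ (λ u∈ → u-fresh (subst (u ∈_) (ListP.++-assoc A [ x ] B) (∈-++⁺ˡ u∈)))
        (proj₁ (Unique-++⁻ (A ++ [ x ]) (subst Unique (sym (ListP.++-assoc A [ x ] B)) (AllPairs.tail unique′))))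
      on-cycle : ∀ {z} → z ∈ A ++ [ x ] → z ∈ A ⊎ z ∈ x ∷ B
      on-cycle z∈ with ∈-++⁻ A z∈
      ... | inj₁ z∈A = inj₁ z∈A
      ... | inj₂ (here z≡x) = inj₂ (here z≡x)
      forward-nondegenerate : A ≢ [] ⊎ ys ≢ []
      forward-nondegenerate =
        [ inj₂ , (λ { (x≢c₁ , _) → inj₁ (λ { refl → x≢c₁ (sym (ListP.∷-injectiveˡ split)) }) }) ]′ nondegenerate

    backward : parity (length (reverse B) + length ys) ≡ 0ℙ → ⊥
    backward = around (reverse B) backward-linked backward-unique on-cycle backward-nondegenerate
      where
      backward-linked : Linked R (u ∷ reverse B ++ [ x ])
      backward-linked = subst (Linked R) (trans (ListP.reverse-++ (x ∷ B) [ u ]) (cong (u ∷_) (ListP.unfold-reverse x B)))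
        (Linked-reverse R-sym (x ∷ B ++ [ u ]) (Linked-++⁻ʳ (u ∷ A) closed′))
      backward-unique : Unique (u ∷ reverse B ++ [ x ])
      backward-unique =
        Unique-∷ (λ u∈ → u-fresh (∈-++⁺ʳ A (AnyP.reverse⁻ (subst (u ∈_) (sym (ListP.unfold-reverse x B)) u∈))))
          (subst Unique (ListP.unfold-reverse x B) (Unique-reverse (x ∷ B) (proj₁ (proj₂ (Unique-++⁻ A (AllPairs.tail unique′))))))
      on-cycle : ∀ {z} → z ∈ reverse B ++ [ x ] → z ∈ A ⊎ z ∈ x ∷ B
      on-cycle z∈ = inj₂ (AnyP.reverse⁻ (subst (_ ∈_) (sym (ListP.unfold-reverse x B)) z∈))
      backward-nondegenerate : reverse B ≢ [] ⊎ ys ≢ []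
      backward-nondegenerate = [ inj₂ , (λ { (_ , x≢cₗ) → inj₁ (λ B-empty → x≢cₗ (sym (lastOf-∷ʳ⁻ c₁ (c₂ ∷ cs) A x
        (trans split (cong (λ zs → A ++ x ∷ zs) (ListP.reverse-injective B-empty)))))) }) ]′ nondegenerate

    orient : ∀ p → parity (length A + length ys) ≡ p → ⊥
    orient 0ℙ even = forward even
    orient 1ℙ odd = backward (subst (λ k → parity (k + length ys) ≡ 0ℙ) (sym (ListP.length-reverse B))
                      (parity-cancel (length A) (length B) (length ys) cycle-odd odd))

  -- Going around C, out along the path, around D and back passes c₁ only once, and has even length
  -- because both cycles are odd.
  no-joined-cycles : ∀ {u x} (C : RootedCycle u) (D : RootedCycle x) path → Linked R (path ++ [ u ]) →
                     x ≡ headOr u path → All (_∉ others C) path → All (_∉ others C) (others D) → ⊥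
  no-joined-cycles {u} {x} C@(rootedCycle c₁ c₂ cs uniqueC closedC) D path path-linked x-first path-avoids D-avoids =
    no-even-closed-walk u c₁ c₂ m walk m-odd c₁-once
      (λ c₁≡u → Unique[x∷xs]⇒x∉xs uniqueC (here (sym c₁≡u)))
      (λ c₂≡u → Unique[x∷xs]⇒x∉xs uniqueC (there (here (sym c₂≡u))))
    where
    excursion : List (Fin n)
    excursion = reverse path ++ others D ++ path
    m : List (Fin n)
    m = cs ++ u ∷ excursion
    excursion-linked : ∀ path → Linked R (path ++ [ u ]) → x ≡ headOr u path → Linked R (u ∷ reverse path ++ others D ++ path ++ [ u ])
    excursion-linked [] _ refl = closed D
    excursion-linked (_ ∷ rest) linked refl = subst (Linked R) reassociate
      (Linked-join (u ∷ reverse rest) backwards (Linked-join (x ∷ others D) (closed D) linked))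
      where
      backwards : Linked R ((u ∷ reverse rest) ++ [ x ])
      backwards = subst (Linked R) (trans (ListP.reverse-++ (x ∷ rest) [ u ]) (cong (u ∷_) (ListP.unfold-reverse x rest)))
        (Linked-reverse R-sym (x ∷ rest ++ [ u ]) linked)
      reassociate : (u ∷ reverse rest) ++ x ∷ (others D ++ x ∷ rest ++ [ u ]) ≡ u ∷ reverse (x ∷ rest) ++ others D ++ (x ∷ rest) ++ [ u ]
      reassociate = cong (u ∷_) (trans (sym (ListP.++-assoc (reverse rest) [ x ] _))
                      (cong (_++ (others D ++ x ∷ rest ++ [ u ])) (sym (ListP.unfold-reverse x rest))))
    walk : Linked R (u ∷ c₁ ∷ c₂ ∷ m ++ [ u ])
    walk = subst (λ zs → Linked R (u ∷ c₁ ∷ c₂ ∷ zs)) reassociate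
             (Linked-join (u ∷ c₁ ∷ c₂ ∷ cs) closedC (excursion-linked path path-linked x-first))
      where
      reassociate : cs ++ u ∷ (reverse path ++ others D ++ path ++ [ u ]) ≡ m ++ [ u ]
      reassociate = sym (trans (ListP.++-assoc cs (u ∷ excursion) [ u ])
        (cong (λ zs → cs ++ u ∷ zs) (trans (ListP.++-assoc (reverse path) (others D ++ path) [ u ])
          (cong (reverse path ++_) (ListP.++-assoc (others D) path [ u ])))))
    excursion-even : parity (length excursion) ≡ 0ℙ
    excursion-even = begin
      parity (length excursion)                                          ≡⟨ cong parity (trans (ListP.length-++ (reverse path))
                                                                              (cong₂ _+_ (ListP.length-reverse path) (ListP.length-++ (others D)))) ⟩
      parity (length path + (length (others D) + length path))           ≡⟨ parity-t+[d+t] (length path) (length (others D)) ⟩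
      parity (length (RootedCycle.cs D))                                 ≡⟨ RootedCycle-odd D ⟩
      0ℙ                                                                 ∎
      where open ≡-Reasoning
    m-odd : parity (length m) ≡ 1ℙ
    m-odd = trans (cong parity (ListP.length-++ cs)) (parity-+-suc≡1ℙ (length cs) (length excursion)
              (trans (ℙP.+-homo-+ (length cs) (length excursion)) (cong₂ ℙ._+_ (RootedCycle-odd C) excursion-even)))
    c₁-once : c₁ ∉ c₂ ∷ m
    c₁-once (here c₁≡c₂) = Unique[x∷xs]⇒x∉xs (AllPairs.tail uniqueC) (here c₁≡c₂)
    c₁-once (there c₁∈m) with ∈-++⁻ cs c₁∈m
    ... | inj₁ c₁∈cs = Unique[x∷xs]⇒x∉xs (AllPairs.tail uniqueC) (there c₁∈cs)
    ... | inj₂ (here c₁≡u) = Unique[x∷xs]⇒x∉xs uniqueC (here (sym c₁≡u))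
    ... | inj₂ (there c₁∈excursion) with ∈-++⁻ (reverse path) c₁∈excursion
    ...   | inj₁ c₁∈ = avoided path-avoids (here refl) (AnyP.reverse⁻ c₁∈)
    ...   | inj₂ c₁∈ with ∈-++⁻ (others D) c₁∈
    ...     | inj₁ c₁∈D = avoided D-avoids (here refl) c₁∈D
    ...     | inj₂ c₁∈path = avoided path-avoids (here refl) c₁∈path

  -- A walk leaving u through w either comes back to C or runs into itself, closing a second cycle.
  root-neighbours : ∀ {u} (C : RootedCycle u) {w} → R u w → w ≢ c₁ C → w ≢ cₗ C → ⊥
  root-neighbours {u} C {w} r w≢c₁ w≢cₗ with w ∈? others C
  ... | yes w∈C = no-path-into-cycle C w∈C [] (R-sym r ∷ [-]) [] (inj₂ (w≢c₁ , w≢cₗ))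
  ... | no w∉C = follow (Trail.stop t)
    where
    open Search (_∈ u ∷ others C) (_∈? u ∷ others C) u (here refl)
    t : Trail w
    t = trail w (λ { (here w≡u) → R-irrefl r (sym w≡u) ; (there w∈C) → w∉C w∈C }) (R-sym r)
    off-C : ∀ {zs} → All (_∉ u ∷ others C) zs → All (_∉ others C) zs
    off-C = All.map (λ z∉ z∈ → z∉ (there z∈))
    follow : Trail.out t ∈ u ∷ others C ⊎ ∃₂ (λ b bs → Trail.behind t ≡ b ∷ bs × Trail.out t ∈ bs) → ⊥
    follow (inj₁ (here out≡u)) with closes-at-root t out≡u
    ... | D , _ , _ , D-avoids = no-joined-cycles C D [] [-] refl [] (off-C D-avoids)
    follow (inj₁ (there out∈C)) =
      no-path-into-cycle C out∈C (Trail.head t ∷ Trail.behind t) (R-sym (Trail.out-step t) ∷ Trail.linked t)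
        (Trail.avoids t) (inj₁ (λ ()))
    follow (inj₂ loop) = no-joined-cycles C cycle (x ∷ stem) stem-linked refl (off-C stem-avoids) (off-C cycle-avoids)
      where open Lollipop (loops t loop)

  edge-on-cycle : ∀ {u a} → R u a → ∃ λ (C : RootedCycle u) → cₗ C ≡ a
  edge-on-cycle {u} {a} r = follow (Trail.stop t)
    where
    open Search (_≡ u) (FinP._≟ u) u refl
    t : Trail a
    t = trail a (λ a≡u → R-irrefl r (sym a≡u)) (R-sym r)
    follow : Trail.out t ≡ u ⊎ ∃₂ (λ b bs → Trail.behind t ≡ b ∷ bs × Trail.out t ∈ bs) → ∃ λ (C : RootedCycle u) → cₗ C ≡ a
    follow (inj₁ out≡u) with closes-at-root t out≡u
    ... | C , _ , cₗ≡a , _ = C , cₗ≡a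
    follow (inj₂ loop) = ⊥-elim (root-neighbours cycle stem-leaves stem-leaves-c₁ stem-leaves-cₗ)
      where open Lollipop (loops t loop)

  at-most-two-neighbours : ∀ {u a b c} → R u a → R u b → R u c → a ≢ b → a ≢ c → b ≢ c → ⊥
  at-most-two-neighbours {u} {a} {b} {c} ra rb rc a≢b a≢c b≢c with edge-on-cycle ra
  ... | C , cₗ≡a with b FinP.≟ c₁ C
  ...   | yes b≡c₁ = root-neighbours C rc (λ c≡c₁ → b≢c (trans b≡c₁ (sym c≡c₁))) (λ c≡cₗ → a≢c (trans (sym cₗ≡a) (sym c≡cₗ)))
  ...   | no b≢c₁ = root-neighbours C rb b≢c₁ (λ b≡cₗ → a≢b (trans (sym cₗ≡a) (sym b≡cₗ)))

  toCycle : ∀ {u} → RootedCycle u → Cycle n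
  toCycle {u} C = record
    { len = length (u ∷ others C) ; len≥3 = ℕ.s≤s (ℕ.s≤s (ℕ.s≤s ℕ.z≤n))
    ; vert = List.lookup (u ∷ others C) ; inj = Unique⇒lookup-injective (u ∷ others C) (unique C) }

  toCycle-edges : ∀ {u} (C : RootedCycle u) {m m′} → CycSucc m m′ → R (Cycle.vert (toCycle C) m) (Cycle.vert (toCycle C) m′)
  toCycle-edges {u} C (inj₁ eq) = Linked-lookup (u ∷ others C) (closed C) _ _ eq
  toCycle-edges {u} C {m} {zero} (inj₂ (eq , _)) = Linked-lookup-last (u ∷ others C) (closed C) m eq

  toCycle-odd : ∀ {u} (C : RootedCycle u) → parity (Cycle.len (toCycle C)) ≡ 1ℙ
  toCycle-odd C = trans (parity-suc (length (cs C))) (cong _⁻¹ (RootedCycle-odd C))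

indicator : ∀ {n} → Fin n → Fin n → ℚ
indicator a i = if ⌊ a ≟ i ⌋ then 1ℚ else 0ℚ

indicator-refl : ∀ {n} (a : Fin n) → indicator a a ≡ 1ℚ
indicator-refl a with a ≟ a
... | yes _ = refl
... | no a≢a = ⊥-elim (a≢a refl)

indicator-≢ : ∀ {n} {a i : Fin n} → a ≢ i → indicator a i ≡ 0ℚ
indicator-≢ {a = a} {i} a≢i with a ≟ i
... | yes a≡i = ⊥-elim (a≢i a≡i)
... | no _ = refl

indicator-product-≢ : ∀ {n} (a b c e : Fin n) → ¬ (a ≡ b × c ≡ e) → indicator a b ℚ.* indicator c e ≡ 0ℚ
indicator-product-≢ a b c e ≢ with a ≟ b
... | no _ = ℚP.*-zeroˡ (indicator c e)
... | yes a≡b with c ≟ e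
...   | yes c≡e = ⊥-elim (≢ (a≡b , c≡e))
...   | no _ = ℚP.*-zeroʳ 1ℚ

sum-indicator : ∀ {n} (a : Fin n) (c : ℚ) → ℚΣ.sum (λ i → indicator a i ℚ.* c) ≡ c
sum-indicator a c = begin
  ℚΣ.sum (λ i → indicator a i ℚ.* c)
    ≡⟨ ℚΣ.sum-supported-at _ a (λ i i≢a → trans (cong (ℚ._* c) (indicator-≢ (i≢a ∘ sym))) (ℚP.*-zeroˡ c)) ⟩
  indicator a a ℚ.* c
    ≡⟨ cong (ℚ._* c) (indicator-refl a) ⟩
  1ℚ ℚ.* c
    ≡⟨ ℚP.*-identityˡ c ⟩
  c
    ∎
  where open ≡-Reasoning

edge : ∀ {n} → Fin n → Fin n → Point n
edge v w i j = indicator v i ℚ.* indicator w j ℚ.+ indicator w i ℚ.* indicator v j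

edge-sym : ∀ {n} (v w i j : Fin n) → edge v w i j ≡ edge v w j i
edge-sym v w i j =
  solve 4 (λ a b c e → a :* b :+ c :* e := e :* c :+ b :* a) refl (indicator v i) (indicator w j) (indicator w i) (indicator v j)

edge-≢ : ∀ {n} (v w i j : Fin n) → ¬ (v ≡ i × w ≡ j) → ¬ (w ≡ i × v ≡ j) → edge v w i j ≡ 0ℚ
edge-≢ v w i j vw≢ij wv≢ij = trans (cong₂ ℚ._+_ (indicator-product-≢ v i w j vw≢ij) (indicator-product-≢ w i v j wv≢ij))
                                   (ℚP.+-identityʳ 0ℚ)

edge-self : ∀ {n} {v w : Fin n} → v ≢ w → edge v w v w ≡ 1ℚ
edge-self {v = v} {w} v≢w = begin
  indicator v v ℚ.* indicator w w ℚ.+ indicator w v ℚ.* indicator v w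
    ≡⟨ cong₂ ℚ._+_ (cong₂ ℚ._*_ (indicator-refl v) (indicator-refl w)) (indicator-product-≢ w v v w (λ (w≡v , _) → v≢w (sym w≡v))) ⟩
  1ℚ ℚ.* 1ℚ ℚ.+ 0ℚ   ≡⟨ ℚP.+-identityʳ (1ℚ ℚ.* 1ℚ) ⟩
  1ℚ ℚ.* 1ℚ          ≡⟨ ℚP.*-identityˡ 1ℚ ⟩
  1ℚ                 ∎
  where open ≡-Reasoning

edge-colSum : ∀ {n} (v w j : Fin n) → colSum (edge v w) j ≡ indicator w j ℚ.+ indicator v j
edge-colSum v w j = trans (ℚΣ.∑-distrib-+ (λ i → indicator v i ℚ.* indicator w j) (λ i → indicator w i ℚ.* indicator v j))
                          (cong₂ ℚ._+_ (sum-indicator v (indicator w j)) (sum-indicator w (indicator v j)))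

alternate : ℕ → ℚ → ℚ
alternate zero s = ℚ.- s
alternate (suc k) s = alternate k (ℚ.- s)

alternate-even : ∀ k s → parity k ≡ 0ℙ → alternate k s ≡ ℚ.- s
alternate-even zero s _ = refl
alternate-even (suc (suc k)) s even =
  trans (cong (alternate k) (solve 1 (λ s → :- (:- s) := s) refl s)) (alternate-even k s even)

walkPoint : ∀ {n} → ℚ → List (Fin n) → Point n
walkPoint s [] i j = 0ℚ
walkPoint s (v ∷ []) i j = 0ℚ
walkPoint s (v ∷ w ∷ r) i j = s ℚ.* edge v w i j ℚ.+ walkPoint (ℚ.- s) (w ∷ r) i j

walkPoint-sym : ∀ {n} s (ws : List (Fin n)) i j → walkPoint s ws i j ≡ walkPoint s ws j i
walkPoint-sym s [] i j = refl
walkPoint-sym s (v ∷ []) i j = refl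
walkPoint-sym s (v ∷ w ∷ r) i j = cong₂ (λ x y → s ℚ.* x ℚ.+ y) (edge-sym v w i j) (walkPoint-sym (ℚ.- s) (w ∷ r) i j)

private
  s*0+0≡0 : ∀ s → s ℚ.* 0ℚ ℚ.+ 0ℚ ≡ 0ℚ
  s*0+0≡0 = solve 1 (λ s → s :* con 0ℚ :+ con 0ℚ := con 0ℚ) refl

walkPoint-support : ∀ {n} {F : Fin n → Fin n → Set} → (∀ {i j} → F i j → F j i) →
                    ∀ s ws → Linked F ws → ∀ i j → ¬ F i j → walkPoint s ws i j ≡ 0ℚ
walkPoint-support F-sym s [] _ i j _ = refl
walkPoint-support F-sym s (v ∷ []) _ i j _ = refl
walkPoint-support F-sym s (v ∷ w ∷ r) (f ∷ linked) i j ¬f =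
  trans (cong₂ (λ x y → s ℚ.* x ℚ.+ y)
          (edge-≢ v w i j (λ { (refl , refl) → ¬f f }) (λ { (refl , refl) → ¬f (F-sym f) }))
          (walkPoint-support F-sym (ℚ.- s) (w ∷ r) linked i j ¬f))
        (s*0+0≡0 s)

walkPoint-outside : ∀ {n} s (ws : List (Fin n)) i j → j ∉ ws → walkPoint s ws i j ≡ 0ℚ
walkPoint-outside s [] i j _ = refl
walkPoint-outside s (v ∷ []) i j _ = refl
walkPoint-outside s (v ∷ w ∷ r) i j j∉ =
  trans (cong₂ (λ x y → s ℚ.* x ℚ.+ y)
          (edge-≢ v w i j (λ { (_ , w≡j) → j∉ (there (here (sym w≡j))) }) (λ { (_ , v≡j) → j∉ (here (sym v≡j)) }))
          (walkPoint-outside (ℚ.- s) (w ∷ r) i j (j∉ ∘ there)))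
        (s*0+0≡0 s)

-- interior vertices of the walk receive canceling contributions from their two edges
walkPoint-colSum : ∀ {n} s (v : Fin n) r j →
                   colSum (walkPoint s (v ∷ r)) j ≡ s ℚ.* indicator v j ℚ.+ alternate (length r) s ℚ.* indicator (lastOf v r) j
walkPoint-colSum {n} s v [] j = begin
  ℚΣ.sum (λ (i : Fin n) → 0ℚ)                          ≡⟨ ℚΣ.sum-zero (λ (i : Fin n) → 0ℚ) (λ _ → refl) ⟩
  0ℚ                                                   ≡⟨ solve 2 (λ s a → con 0ℚ := s :* a :+ (:- s) :* a) refl s (indicator v j) ⟩
  s ℚ.* indicator v j ℚ.+ ℚ.- s ℚ.* indicator v j      ∎
  where open ≡-Reasoning
walkPoint-colSum s v (w ∷ r) j = begin
  colSum (walkPoint s (v ∷ w ∷ r)) j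
    ≡⟨ ℚΣ.∑-distrib-+ (λ i → s ℚ.* edge v w i j) (λ i → walkPoint (ℚ.- s) (w ∷ r) i j) ⟩
  ℚΣ.sum (λ i → s ℚ.* edge v w i j) ℚ.+ colSum (walkPoint (ℚ.- s) (w ∷ r)) j
    ≡⟨ cong₂ ℚ._+_ (trans (sym (ℚΣ.*-distribˡ-sum s (λ i → edge v w i j))) (cong (s ℚ.*_) (edge-colSum v w j)))
                   (walkPoint-colSum (ℚ.- s) w r j) ⟩
  s ℚ.* (indicator w j ℚ.+ indicator v j) ℚ.+ (ℚ.- s ℚ.* indicator w j ℚ.+ alternate (length r) (ℚ.- s) ℚ.* indicator (lastOf w r) j)
    ≡⟨ solve 5 (λ s a b c e → s :* (b :+ a) :+ ((:- s) :* b :+ c :* e) := s :* a :+ c :* e) refl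
               s (indicator v j) (indicator w j) (alternate (length r) (ℚ.- s)) (indicator (lastOf w r) j) ⟩
  s ℚ.* indicator v j ℚ.+ alternate (length r) (ℚ.- s) ℚ.* indicator (lastOf w r) j
    ∎
  where open ≡-Reasoning

module Polytope {n : ℕ} (d : Fin n → ℕ) (h : Point n) (h∈P : InP d h) where

  h-sym : ∀ i j → h i j ≡ h j i
  h-sym = proj₁ h∈P

  h-diag : ∀ i → h i i ≡ 0ℚ
  h-diag = proj₁ (proj₂ h∈P)

  h-colSum : ∀ j → colSum h j ≡ ℕ→ℚ (d j)
  h-colSum j = trans (sym (offDiagColSum≡colSum h j (h-diag j))) (proj₁ (proj₂ (proj₂ h∈P)) j)

  h-bounds : ∀ i j → i ≢ j → 0ℚ ℚ.≤ h i j × h i j ℚ.≤ 1ℚ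
  h-bounds = proj₂ (proj₂ (proj₂ h∈P))

  Fractional : Fin n → Fin n → Set
  Fractional i j = i ≢ j × h i j ≢ 0ℚ × h i j ≢ 1ℚ

  Fractional? : ∀ i j → Dec (Fractional i j)
  Fractional? i j = ¬? (i ≟ j) ×-dec ¬? (h i j ℚP.≟ 0ℚ) ×-dec ¬? (h i j ℚP.≟ 1ℚ)

  Fractional-sym : ∀ {i j} → Fractional i j → Fractional j i
  Fractional-sym {i} {j} (i≢j , ≢0 , ≢1) = i≢j ∘ sym , ≢0 ∘ trans (h-sym i j) , ≢1 ∘ trans (h-sym i j)

  Fractional-irrefl : ∀ {i j} → Fractional i j → i ≢ j
  Fractional-irrefl = proj₁

  Fractional-bounds : ∀ {i j} → Fractional i j → 0ℚ ℚ.< h i j × h i j ℚ.< 1ℚ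
  Fractional-bounds {i} {j} (i≢j , ≢0 , ≢1) =
    ≤∧≢⇒< (proj₁ (h-bounds i j i≢j)) (≢0 ∘ sym) , ≤∧≢⇒< (proj₂ (h-bounds i j i≢j)) ≢1

  ¬Fractional⇒0∨1 : ∀ {i j} → i ≢ j → ¬ Fractional i j → h i j ≡ 0ℚ ⊎ h i j ≡ 1ℚ
  ¬Fractional⇒0∨1 {i} {j} i≢j ¬frac with h i j ℚP.≟ 0ℚ | h i j ℚP.≟ 1ℚ
  ... | yes ≡0 | _ = inj₁ ≡0
  ... | no _ | yes ≡1 = inj₂ ≡1
  ... | no ≢0 | no ≢1 = ⊥-elim (¬frac (i≢j , ≢0 , ≢1))

  ¬Fractional⇒IsIntegral : ∀ {i j} → ¬ Fractional i j → IsIntegral (h i j)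
  ¬Fractional⇒IsIntegral {i} {j} ¬frac with i ≟ j
  ... | yes refl = subst IsIntegral (sym (h-diag i)) IsIntegral-0
  ... | no i≢j = [ (λ ≡0 → subst IsIntegral (sym ≡0) IsIntegral-0) , (λ ≡1 → subst IsIntegral (sym ≡1) IsIntegral-1) ]′
                   (¬Fractional⇒0∨1 i≢j ¬frac)

  REdge⇒Fractional : ∀ {i j} → REdge h i j → Fractional i j
  REdge⇒Fractional (i≢j , ¬int) = i≢j , (λ ≡0 → ¬int (subst IsIntegral (sym ≡0) IsIntegral-0))
                                      , (λ ≡1 → ¬int (subst IsIntegral (sym ≡1) IsIntegral-1))

  Fractional⇒REdge : ∀ {i j} → Fractional i j → REdge h i j
  Fractional⇒REdge {i} {j} (i≢j , ≢0 , ≢1) =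
    i≢j , λ int → [ ≢0 , ≢1 ]′ (IsIntegral∩[0,1] int (proj₁ (h-bounds i j i≢j)) (proj₂ (h-bounds i j i≢j)))

  -- Column j sums to the integer d j, so it cannot contain exactly one non-integral entry.
  fractional-branch : ∀ {u w} → Fractional u w → ∃ λ w′ → Fractional u w′ × w′ ≢ w
  fractional-branch {u} {w} frac with FinP.any? (λ i → Fractional? i u ×-dec ¬? (i ≟ w))
  ... | yes (w′ , frac′ , w′≢w) = w′ , Fractional-sym frac′ , w′≢w
  ... | no none = ⊥-elim (proj₂ (Fractional⇒REdge (Fractional-sym frac)) h-wu-integral)
    where
    others-integral : ∀ i → IsIntegral (updateAt (λ i → h i u) w (const 0ℚ) i)
    others-integral i with i ≟ w
    ... | yes refl = subst IsIntegral (sym (updateAt-updates w _)) IsIntegral-0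
    ... | no i≢w = subst IsIntegral (sym (updateAt-minimal i w _ i≢w))
                     (¬Fractional⇒IsIntegral (λ frac′ → none (i , frac′ , i≢w)))
    h-wu-integral : IsIntegral (h w u)
    h-wu-integral = IsIntegral-cancelʳ (trans (sym (ℚΣ.sum-updateAt-0# (λ i → h i u) w)) (h-colSum u))
                      (IsIntegral-sum _ others-integral) (IsIntegral-ℕ→ℚ (d u))

  -- the directions of P(d) at h that move only the fractional coordinates
  Balanced : Point n → Set
  Balanced δ = (∀ i j → δ i j ≡ δ j i) × (∀ j → colSum δ j ≡ 0ℚ) × (∀ i j → ¬ Fractional i j → δ i j ≡ 0ℚ)

  Rigid : Set
  Rigid = ∀ δ → Balanced δ → ∀ i j → δ i j ≡ 0ℚ

  perturb : ℚ → Point n → Point n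
  perturb c δ i j = h i j ℚ.+ c ℚ.* δ i j

  perturb-∈P : ∀ {δ} c → Balanced δ →
               (∀ i j → i ≢ j → 0ℚ ℚ.≤ perturb c δ i j × perturb c δ i j ℚ.≤ 1ℚ) → InP d (perturb c δ)
  perturb-∈P {δ} c (δ-sym , δ-colSum , δ-support) bounds =
    (λ i j → cong₂ (λ x y → x ℚ.+ c ℚ.* y) (h-sym i j) (δ-sym i j)) , diag , colSum≡d , bounds
    where
    diag : ∀ i → perturb c δ i i ≡ 0ℚ
    diag i = begin
      h i i ℚ.+ c ℚ.* δ i i   ≡⟨ cong₂ (λ x y → x ℚ.+ c ℚ.* y) (h-diag i) (δ-support i i (λ frac → Fractional-irrefl frac refl)) ⟩
      0ℚ ℚ.+ c ℚ.* 0ℚ         ≡⟨ ℚP.+-identityˡ (c ℚ.* 0ℚ) ⟩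
      c ℚ.* 0ℚ                ≡⟨ ℚP.*-zeroʳ c ⟩
      0ℚ                      ∎
      where open ≡-Reasoning
    colSum≡d : ∀ j → offDiagColSum (perturb c δ) j ≡ ℕ→ℚ (d j)
    colSum≡d j = begin
      offDiagColSum (perturb c δ) j                      ≡⟨ offDiagColSum≡colSum (perturb c δ) j (diag j) ⟩
      colSum (perturb c δ) j                             ≡⟨ ℚΣ.∑-distrib-+ (λ i → h i j) (λ i → c ℚ.* δ i j) ⟩
      colSum h j ℚ.+ ℚΣ.sum (λ i → c ℚ.* δ i j)          ≡⟨ cong (colSum h j ℚ.+_) (ℚΣ.*-distribˡ-sum c (λ i → δ i j)) ⟨
      colSum h j ℚ.+ c ℚ.* colSum δ j                    ≡⟨ cong₂ (λ x y → x ℚ.+ c ℚ.* y) (h-colSum j) (δ-colSum j) ⟩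
      ℕ→ℚ (d j) ℚ.+ c ℚ.* 0ℚ                             ≡⟨ solve 2 (λ x c → x :+ c :* con 0ℚ := x) refl (ℕ→ℚ (d j)) c ⟩
      ℕ→ℚ (d j)                                          ∎
      where open ≡-Reasoning

  -- h ± εδ both lie in P(d) for small ε > 0, and h is their midpoint.
  vertex⇒rigid : IsVertex d h → Rigid
  vertex⇒rigid (_ , extreme) δ balanced@(_ , _ , δ-support) i j =
    *-cancelˡ-pos-zero 0<ε (trans (x≡½*[x+x] (ε ℚ.* δ i j)) (trans (cong (½ ℚ.*_) twice-zero) (ℚP.*-zeroʳ ½)))
    where
    room : Fin n → Fin n → ℚ
    room i j with Fractional? i j
    ... | yes _ = safeStep (h i j) (δ i j)
    ... | no _ = 1ℚ
    room-pos : ∀ i j → 0ℚ ℚ.< room i j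
    room-pos i j with Fractional? i j
    ... | yes frac = safeStep-pos (δ i j) (proj₁ (Fractional-bounds frac)) (proj₂ (Fractional-bounds frac))
    ... | no _ = 0<1
    bound : ∃ λ ε → 0ℚ ℚ.< ε × (∀ i j → ε ℚ.≤ room i j)
    bound = uniform-lower-bound₂ room room-pos
    ε : ℚ
    ε = proj₁ bound
    0<ε : 0ℚ ℚ.< ε
    0<ε = proj₁ (proj₂ bound)
    within : ∀ i j → i ≢ j →
      (0ℚ ℚ.≤ perturb ε δ i j × perturb ε δ i j ℚ.≤ 1ℚ) × (0ℚ ℚ.≤ perturb (ℚ.- ε) δ i j × perturb (ℚ.- ε) δ i j ℚ.≤ 1ℚ)
    within i j i≢j with Fractional? i j | proj₂ (proj₂ bound) i j
    ... | yes frac | ε≤room = step-within-[0,1] (δ i j) (proj₁ (Fractional-bounds frac)) (proj₂ (Fractional-bounds frac)) (ℚP.<⇒≤ 0<ε) ε≤room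
    ... | no ¬frac | _ = unmoved ε , unmoved (ℚ.- ε)
      where
      unmoved : ∀ c → 0ℚ ℚ.≤ perturb c δ i j × perturb c δ i j ℚ.≤ 1ℚ
      unmoved c = subst (λ x → 0ℚ ℚ.≤ x × x ℚ.≤ 1ℚ) (sym h≡) (h-bounds i j i≢j)
        where
        h≡ : perturb c δ i j ≡ h i j
        h≡ = trans (cong (λ y → h i j ℚ.+ c ℚ.* y) (δ-support i j ¬frac))
               (solve 2 (λ x c → x :+ c :* con 0ℚ := x) refl (h i j) c)
    equal : perturb ε δ i j ≡ perturb (ℚ.- ε) δ i j
    equal = extreme (perturb ε δ) (perturb (ℚ.- ε) δ) ½
      (perturb-∈P ε balanced (λ i j → proj₁ ∘ within i j)) (perturb-∈P (ℚ.- ε) balanced (λ i j → proj₂ ∘ within i j))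
      0<½ ½<1 (λ i j → solve 3 (λ x e y → x := con ½ :* (x :+ e :* y) :+ (con 1ℚ :- con ½) :* (x :+ (:- e) :* y))
                                refl (h i j) ε (δ i j)) i j
    twice-zero : ε ℚ.* δ i j ℚ.+ ε ℚ.* δ i j ≡ 0ℚ
    twice-zero = begin
      ε ℚ.* δ i j ℚ.+ ε ℚ.* δ i j                     ≡⟨ solve 3 (λ x e y → e :* y :+ e :* y := (x :+ e :* y) :- (x :+ (:- e) :* y))
                                                           refl (h i j) ε (δ i j) ⟩
      perturb ε δ i j ℚ.- perturb (ℚ.- ε) δ i j       ≡⟨ cong (ℚ._- perturb (ℚ.- ε) δ i j) equal ⟩
      perturb (ℚ.- ε) δ i j ℚ.- perturb (ℚ.- ε) δ i j ≡⟨ ℚP.+-inverseʳ (perturb (ℚ.- ε) δ i j) ⟩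
      0ℚ                                              ∎
      where open ≡-Reasoning

  -- Where h is 0 or 1, so are a and b, and they agree with h.
  rigid⇒vertex : Rigid → IsVertex d h
  rigid⇒vertex rigid = h∈P , λ a b t a∈P b∈P 0<t t<1 h≡ i j →
    trans (solve 2 (λ x y → x := (x :- y) :+ y) refl (a i j) (b i j))
      (trans (cong (ℚ._+ b i j) (rigid (λ i j → a i j ℚ.- b i j) (balanced a b t a∈P b∈P 0<t t<1 h≡) i j)) (ℚP.+-identityˡ (b i j)))
    where
    balanced : ∀ a b t → InP d a → InP d b → 0ℚ ℚ.< t → t ℚ.< 1ℚ →
               (∀ i j → h i j ≡ t ℚ.* a i j ℚ.+ (1ℚ ℚ.- t) ℚ.* b i j) → Balanced (λ i j → a i j ℚ.- b i j)
    balanced a b t (a-sym , a-diag , a-col , a-bounds) (b-sym , b-diag , b-col , b-bounds) 0<t t<1 h≡ =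
      (λ i j → cong₂ ℚ._-_ (a-sym i j) (b-sym i j)) , colSum≡0 , support
      where
      col : ∀ (x : Point n) → (∀ i → x i i ≡ 0ℚ) → (∀ j → offDiagColSum x j ≡ ℕ→ℚ (d j)) → ∀ j → colSum x j ≡ ℕ→ℚ (d j)
      col x x-diag x-col j = trans (sym (offDiagColSum≡colSum x j (x-diag j))) (x-col j)
      colSum≡0 : ∀ j → colSum (λ i j → a i j ℚ.- b i j) j ≡ 0ℚ
      colSum≡0 j = begin
        colSum (λ i j → a i j ℚ.- b i j) j
          ≡⟨ solve 2 (λ s t → s := (s :+ t) :- t) refl _ (colSum b j) ⟩
        colSum (λ i j → a i j ℚ.- b i j) j ℚ.+ colSum b j ℚ.- colSum b j
          ≡⟨ cong (ℚ._- colSum b j) (ℚΣ.∑-distrib-+ (λ i → a i j ℚ.- b i j) (λ i → b i j)) ⟨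
        ℚΣ.sum (λ i → a i j ℚ.- b i j ℚ.+ b i j) ℚ.- colSum b j
          ≡⟨ cong (ℚ._- colSum b j) (ℚΣ.sum-cong-≗ (λ i → solve 2 (λ x y → x :- y :+ y := x) refl (a i j) (b i j))) ⟩
        colSum a j ℚ.- colSum b j
          ≡⟨ cong₂ ℚ._-_ (col a a-diag a-col j) (col b b-diag b-col j) ⟩
        ℕ→ℚ (d j) ℚ.- ℕ→ℚ (d j)
          ≡⟨ ℚP.+-inverseʳ (ℕ→ℚ (d j)) ⟩
        0ℚ
          ∎
        where open ≡-Reasoning
      support : ∀ i j → ¬ Fractional i j → a i j ℚ.- b i j ≡ 0ℚ
      support i j ¬frac with i ≟ j
      ... | yes refl = trans (cong (ℚ._- b i i) (trans (a-diag i) (sym (b-diag i)))) (ℚP.+-inverseʳ (b i i))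
      ... | no i≢j = [ at-0 , at-1 ]′ (¬Fractional⇒0∨1 i≢j ¬frac)
        where
        a∈ : 0ℚ ℚ.≤ a i j × a i j ℚ.≤ 1ℚ
        a∈ = a-bounds i j i≢j
        b∈ : 0ℚ ℚ.≤ b i j × b i j ℚ.≤ 1ℚ
        b∈ = b-bounds i j i≢j
        at-0 : h i j ≡ 0ℚ → a i j ℚ.- b i j ≡ 0ℚ
        at-0 h≡0 = trans (cong (ℚ._- b i j) (trans (proj₁ zeros) (sym (proj₂ zeros)))) (ℚP.+-inverseʳ (b i j))
          where
          zeros : a i j ≡ 0ℚ × b i j ≡ 0ℚ
          zeros = convex-combination-zero 0<t t<1 (proj₁ a∈) (proj₁ b∈) (trans (sym (h≡ i j)) h≡0)
        complement : h i j ≡ 1ℚ → t ℚ.* (1ℚ ℚ.- a i j) ℚ.+ (1ℚ ℚ.- t) ℚ.* (1ℚ ℚ.- b i j) ≡ 0ℚ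
        complement h≡1 = begin
          t ℚ.* (1ℚ ℚ.- a i j) ℚ.+ (1ℚ ℚ.- t) ℚ.* (1ℚ ℚ.- b i j)
            ≡⟨ solve 3 (λ t x y → t :* (con 1ℚ :- x) :+ (con 1ℚ :- t) :* (con 1ℚ :- y)
                                  := con 1ℚ :- (t :* x :+ (con 1ℚ :- t) :* y)) refl t (a i j) (b i j) ⟩
          1ℚ ℚ.- mix
            ≡⟨ cong (ℚ._- mix) (trans (sym h≡1) (h≡ i j)) ⟩
          mix ℚ.- mix
            ≡⟨ ℚP.+-inverseʳ mix ⟩
          0ℚ
            ∎
          where
          open ≡-Reasoning
          mix : ℚ
          mix = t ℚ.* a i j ℚ.+ (1ℚ ℚ.- t) ℚ.* b i j
        at-1 : h i j ≡ 1ℚ → a i j ℚ.- b i j ≡ 0ℚ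
        at-1 h≡1 = trans (solve 2 (λ x y → x :- y := (con 1ℚ :- y) :- (con 1ℚ :- x)) refl (a i j) (b i j))
          (trans (cong (ℚ._- (1ℚ ℚ.- a i j)) (trans (proj₂ zeros) (sym (proj₁ zeros)))) (ℚP.+-inverseʳ (1ℚ ℚ.- a i j)))
          where
          zeros : 1ℚ ℚ.- a i j ≡ 0ℚ × 1ℚ ℚ.- b i j ≡ 0ℚ
          zeros = convex-combination-zero 0<t t<1 (p≤q⇒0≤q-p (proj₂ a∈)) (p≤q⇒0≤q-p (proj₂ b∈)) (complement h≡1)

  -- Alternating signs along an even closed walk balance every column, while the edge u w,
  -- traversed once, keeps weight 1.
  rigid⇒no-even-closed-walk : Rigid → ∀ u w v m → Linked Fractional (u ∷ w ∷ v ∷ m ++ [ u ]) →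
                              parity (length m) ≡ 1ℙ → w ∉ v ∷ m → w ≢ u → v ≢ u → ⊥
  rigid⇒no-even-closed-walk rigid u w v m linked m-odd w-once w≢u v≢u = ℚP.1≢0 (trans (sym δ-uw≡1) (rigid δ balanced u w))
    where
    rest : List (Fin n)
    rest = m ++ [ u ]
    δ : Point n
    δ = walkPoint 1ℚ (u ∷ w ∷ v ∷ rest)
    rest-even : parity (length rest) ≡ 0ℙ
    rest-even = trans (cong parity (trans (ListP.length-++ m) (ℕP.+-comm (length m) 1)))
                      (trans (parity-suc (length m)) (cong ℙ._⁻¹ m-odd))
    colSum≡0 : ∀ j → colSum δ j ≡ 0ℚ
    colSum≡0 j = begin
      colSum δ j
        ≡⟨ walkPoint-colSum 1ℚ u (w ∷ v ∷ rest) j ⟩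
      1ℚ ℚ.* indicator u j ℚ.+ alternate (length rest) (ℚ.- ℚ.- 1ℚ) ℚ.* indicator (lastOf v rest) j
        ≡⟨ cong₂ (λ x y → 1ℚ ℚ.* indicator u j ℚ.+ x ℚ.* indicator y j) (alternate-even (length rest) _ rest-even) (lastOf-∷ʳ v m u) ⟩
      1ℚ ℚ.* indicator u j ℚ.+ ℚ.- (ℚ.- ℚ.- 1ℚ) ℚ.* indicator u j
        ≡⟨ solve 1 (λ a → con 1ℚ :* a :+ (:- (:- (:- con 1ℚ))) :* a := con 0ℚ) refl (indicator u j) ⟩
      0ℚ
        ∎
      where open ≡-Reasoning
    balanced : Balanced δ
    balanced = walkPoint-sym 1ℚ (u ∷ w ∷ v ∷ rest) , colSum≡0 , walkPoint-support Fractional-sym 1ℚ (u ∷ w ∷ v ∷ rest) linked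
    δ-uw≡1 : δ u w ≡ 1ℚ
    δ-uw≡1 = begin
      1ℚ ℚ.* edge u w u w ℚ.+ (ℚ.- 1ℚ ℚ.* edge w v u w ℚ.+ walkPoint (ℚ.- ℚ.- 1ℚ) (v ∷ rest) u w)
        ≡⟨ cong₂ (λ x y → 1ℚ ℚ.* x ℚ.+ y) (edge-self (w≢u ∘ sym))
                 (cong₂ (λ x y → ℚ.- 1ℚ ℚ.* x ℚ.+ y) (edge-≢ w v u w (w≢u ∘ proj₁) (v≢u ∘ proj₁))
                        (walkPoint-outside _ (v ∷ rest) u w w-once′)) ⟩
      1ℚ ℚ.* 1ℚ ℚ.+ (ℚ.- 1ℚ ℚ.* 0ℚ ℚ.+ 0ℚ)   ≡⟨ solve 0 (con 1ℚ :* con 1ℚ :+ (:- con 1ℚ :* con 0ℚ :+ con 0ℚ) := con 1ℚ) refl ⟩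
      1ℚ                                     ∎
      where
      open ≡-Reasoning
      w-once′ : w ∉ v ∷ rest
      w-once′ (here w≡v) = w-once (here w≡v)
      w-once′ (there w∈rest) with ∈-++⁻ m w∈rest
      ... | inj₁ w∈m = w-once (there w∈m)
      ... | inj₂ (here w≡u) = w≢u w≡u

hit : ∀ {n} → Fin n → Fin n → ℕ
hit a j = if ⌊ a ≟ j ⌋ then 1 else 0

hit-≢ : ∀ {n} {a j : Fin n} → a ≢ j → hit a j ≡ 0
hit-≢ {a = a} {j} a≢j with a ≟ j
... | yes a≡j = ⊥-elim (a≢j a≡j)
... | no _ = refl

hit-refl : ∀ {n} (a : Fin n) → hit a a ≡ 1
hit-refl a with a ≟ a
... | yes _ = refl
... | no a≢a = ⊥-elim (a≢a refl)

sum-hit : ∀ {n} (a : Fin n) → ℕΣ.sum (hit a) ≡ 1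
sum-hit a = trans (ℕΣ.sum-supported-at (hit a) a (λ j j≢a → hit-≢ (j≢a ∘ sym))) (hit-refl a)

module CycleDecompositions {n : ℕ} (d : Fin n → ℕ) (h : Point n) (h∈P : InP d h) where
  open Polytope d h h∈P

  FractionalCycle : Cycle n → Set
  FractionalCycle C = ∀ {m m′} → CycSucc m m′ → Fractional (Cycle.vert C m) (Cycle.vert C m′)

  Chordless : Cycle n → Set
  Chordless C = ∀ m {b} → Fractional (Cycle.vert C m) b → b ≡ Cycle.vert C (next m) ⊎ b ≡ Cycle.vert C (prev m)

  next≢prev-vert : ∀ (C : Cycle n) m → Cycle.vert C (next m) ≢ Cycle.vert C (prev m)
  next≢prev-vert C m = next≢prev (Cycle.len≥3 C) m ∘ Cycle.inj C

  module FromDecomposition (Cs : List (Cycle n)) (dec : OddCycleDecomposition h Cs) where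

    cycle : Fin (length Cs) → Cycle n
    cycle = List.lookup Cs

    vert : ∀ p → Fin (Cycle.len (cycle p)) → Fin n
    vert p = Cycle.vert (cycle p)

    private
      odd = proj₁ dec
      disjoint = proj₁ (proj₂ dec)
      edges = proj₂ (proj₂ dec)

    cycle-odd : ∀ p → parity (Cycle.len (cycle p)) ≡ 1ℙ
    cycle-odd p = %2≡1⇒parity≡1ℙ (Cycle.len (cycle p)) (odd p)

    cycle-fractional : ∀ p → FractionalCycle (cycle p)
    cycle-fractional p {m} {m′} succ = REdge⇒Fractional (proj₂ (edges (vert p m) (vert p m′)) (p , m , m′ , succ , inj₁ (refl , refl)))

    cycle-chordless : ∀ p → Chordless (cycle p)
    cycle-chordless p m {b} frac = on-cycle (proj₁ (edges (vert p m) b) (Fractional⇒REdge frac))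
      where
      same-cycle : ∀ q k k′ → CycSucc k k′ → (vert q k ≡ vert p m × vert q k′ ≡ b) ⊎ (vert q k ≡ b × vert q k′ ≡ vert p m) →
                   Dec (q ≡ p) → b ≡ vert p (next m) ⊎ b ≡ vert p (prev m)
      same-cycle q k k′ _ (inj₁ (k≡m , _)) (no q≢p) = ⊥-elim (disjoint q p q≢p k m k≡m)
      same-cycle q k k′ _ (inj₂ (_ , k′≡m)) (no q≢p) = ⊥-elim (disjoint q p q≢p k′ m k′≡m)
      same-cycle q k k′ succ (inj₁ (k≡m , k′≡b)) (yes refl) =
        inj₁ (trans (sym k′≡b) (cong (vert p) (CycSucc-functional (subst (λ z → CycSucc z k′) (Cycle.inj (cycle p) k≡m) succ) (CycSucc-next m))))
      same-cycle q k k′ succ (inj₂ (k≡b , k′≡m)) (yes refl) =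
        inj₂ (trans (sym k≡b) (cong (vert p) (CycSucc-injective (subst (CycSucc k) (Cycle.inj (cycle p) k′≡m) succ) (CycSucc-prev m))))
      on-cycle : (∃ λ q → CycleEdge (cycle q) (vert p m) b) → b ≡ vert p (next m) ⊎ b ≡ vert p (prev m)
      on-cycle (q , k , k′ , succ , ends) = same-cycle q k k′ succ ends (q FinP.≟ p)

    fractional-on-cycle : ∀ {i j} → Fractional i j → ∃₂ λ p m → vert p m ≡ i × (j ≡ vert p (next m) ⊎ j ≡ vert p (prev m))
    fractional-on-cycle {i} {j} frac with proj₁ (edges i j) (Fractional⇒REdge frac)
    ... | p , k , k′ , _ , inj₁ (k≡i , _) = p , k , k≡i , cycle-chordless p k (subst (λ z → Fractional z j) (sym k≡i) frac)
    ... | p , k , k′ , _ , inj₂ (_ , k′≡i) = p , k′ , k′≡i , cycle-chordless p k′ (subst (λ z → Fractional z j) (sym k′≡i) frac)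

    module AtVertex (p : Fin (length Cs)) (m : Fin (Cycle.len (cycle p))) where

      v a b : Fin n
      v = vert p m
      a = vert p (prev m)
      b = vert p (next m)

      a-fractional : Fractional a v
      a-fractional = cycle-fractional p (CycSucc-prev m)

      b-fractional : Fractional b v
      b-fractional = Fractional-sym (cycle-fractional p (CycSucc-next m))

      offCycle : Point n → Fin n → ℚ
      offCycle x = ℚΣ.without₂ (λ i → x i v) a b

      colSum-split : ∀ x → colSum x v ≡ x a v ℚ.+ (x b v ℚ.+ ℚΣ.sum (offCycle x))
      colSum-split x = ℚΣ.sum-without₂ (λ i → x i v) (next≢prev-vert (cycle p) m ∘ sym)

      offCycle-pointwise : ∀ x (P : ℚ → Set) → P 0ℚ → (∀ i → ¬ Fractional i v → P (x i v)) → ∀ i → P (offCycle x i)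
      offCycle-pointwise x P P0 Px = ℚΣ.without₂-pointwise P (λ i → x i v) a b P0
        (λ i i≢a i≢b → Px i (λ frac → [ i≢b , i≢a ]′ (cycle-chordless p m (Fractional-sym frac))))

    module _ (x : Point n) (x-sym : ∀ i j → x i j ≡ x j i) (c : ℚ)
             (pair-sum : ∀ p m → x (vert p (prev m)) (vert p m) ℚ.+ x (vert p (next m)) (vert p m) ≡ c) where

      constant-along-cycle : ∀ p k → x (vert p k) (vert p (next k)) ≡ ½ ℚ.* c
      constant-along-cycle p = alternating-odd-cycle (cycle-odd p) (λ k → x (vert p k) (vert p (next k))) c consecutive
        where
        consecutive : ∀ k → x (vert p k) (vert p (next k)) ℚ.+ x (vert p (next k)) (vert p (next (next k))) ≡ c
        consecutive k = trans (cong₂ ℚ._+_ (cong (λ z → x (vert p z) (vert p (next k)))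
                                               (CycSucc-injective (CycSucc-next k) (CycSucc-prev (next k))))
                                         (x-sym _ _))
                              (pair-sum p (next k))

      constant-on-cycles : ∀ {i j} → Fractional i j → x i j ≡ ½ ℚ.* c
      constant-on-cycles frac with fractional-on-cycle frac
      ... | p , m , refl , inj₁ refl = constant-along-cycle p m
      ... | p , m , refl , inj₂ refl =
        trans (x-sym _ _) (trans (cong (λ z → x (vert p (prev m)) (vert p z)) (CycSucc-functional (CycSucc-prev m) (CycSucc-next (prev m))))
                                 (constant-along-cycle p (prev m)))

    decomposition⇒rigid : Rigid
    decomposition⇒rigid δ (δ-sym , δ-colSum , δ-support) i j with Fractional? i j
    ... | no ¬frac = δ-support i j ¬frac
    ... | yes frac = trans (constant-on-cycles δ δ-sym 0ℚ pair-sum frac) (ℚP.*-zeroʳ ½)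
      where
      pair-sum : ∀ p m → δ (vert p (prev m)) (vert p m) ℚ.+ δ (vert p (next m)) (vert p m) ≡ 0ℚ
      pair-sum p m = begin
        δ a v ℚ.+ δ b v                              ≡⟨ solve 2 (λ x y → x :+ y := x :+ (y :+ con 0ℚ)) refl (δ a v) (δ b v) ⟩
        δ a v ℚ.+ (δ b v ℚ.+ 0ℚ)                     ≡⟨ cong (λ s → δ a v ℚ.+ (δ b v ℚ.+ s)) off-zero ⟨
        δ a v ℚ.+ (δ b v ℚ.+ ℚΣ.sum (offCycle δ))    ≡⟨ colSum-split δ ⟨
        colSum δ v                                   ≡⟨ δ-colSum v ⟩
        0ℚ                                           ∎
        where
        open ≡-Reasoning
        open AtVertex p m
        off-zero : ℚΣ.sum (offCycle δ) ≡ 0ℚ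
        off-zero = ℚΣ.sum-zero (offCycle δ) (offCycle-pointwise δ (_≡ 0ℚ) refl (λ i → δ-support i v))

    -- At a cycle vertex the two fractional entries of its column sum to an integer in (0, 2).
    decomposition⇒half : ∀ {i j} → Fractional i j → h i j ≡ ½
    decomposition⇒half frac = trans (constant-on-cycles h h-sym 1ℚ pair-sum frac) (ℚP.*-identityʳ ½)
      where
      pair-sum : ∀ p m → h (vert p (prev m)) (vert p m) ℚ.+ h (vert p (next m)) (vert p m) ≡ 1ℚ
      pair-sum p m = IsIntegral∩⟨0,2⟩ integral
        (ℚP.+-mono-< (proj₁ (Fractional-bounds a-fractional)) (proj₁ (Fractional-bounds b-fractional)))
        (ℚP.+-mono-< (proj₂ (Fractional-bounds a-fractional)) (proj₂ (Fractional-bounds b-fractional)))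
        where
        open AtVertex p m
        integral : IsIntegral (h a v ℚ.+ h b v)
        integral = IsIntegral-cancelʳ (trans (ℚP.+-assoc (h a v) (h b v) _) (trans (sym (colSum-split h)) (h-colSum v)))
          (IsIntegral-sum _ (offCycle-pointwise h IsIntegral IsIntegral-0 (λ i → ¬Fractional⇒IsIntegral)))
          (IsIntegral-ℕ→ℚ (d v))

    covers : Fin n → ℕ
    covers j = ℕΣ.sum (λ p → ℕΣ.sum (λ m → hit (vert p m) j))

    covers-on : ∀ p m → covers (vert p m) ≡ 1
    covers-on p m = begin
      covers (vert p m)
        ≡⟨ ℕΣ.sum-supported-at _ p (λ q q≢p → ℕΣ.sum-zero _ (λ k → hit-≢ (disjoint q p q≢p k m))) ⟩
      ℕΣ.sum (λ k → hit (vert p k) (vert p m))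
        ≡⟨ ℕΣ.sum-supported-at _ m (λ k k≢m → hit-≢ (k≢m ∘ Cycle.inj (cycle p))) ⟩
      hit (vert p m) (vert p m)
        ≡⟨ hit-refl (vert p m) ⟩
      1
        ∎
      where open ≡-Reasoning

    covers-off : ∀ j → ¬ (∃₂ λ p m → vert p m ≡ j) → covers j ≡ 0
    covers-off j uncovered = ℕΣ.sum-zero _ (λ p → ℕΣ.sum-zero _ (λ m → hit-≢ (λ eq → uncovered (p , m , eq))))

    sum-covers : ℕΣ.sum covers ≡ ℕΣ.sum (λ p → Cycle.len (cycle p))
    sum-covers = begin
      ℕΣ.sum (λ j → ℕΣ.sum (λ p → ℕΣ.sum (λ m → hit (vert p m) j)))
        ≡⟨ ℕΣ.∑-comm (λ j p → ℕΣ.sum (λ m → hit (vert p m) j)) ⟩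
      ℕΣ.sum (λ p → ℕΣ.sum (λ j → ℕΣ.sum (λ m → hit (vert p m) j)))
        ≡⟨ ℕΣ.sum-cong-≗ (λ p → ℕΣ.∑-comm (λ j m → hit (vert p m) j)) ⟩
      ℕΣ.sum (λ p → ℕΣ.sum (λ m → ℕΣ.sum (hit (vert p m))))
        ≡⟨ ℕΣ.sum-cong-≗ (λ p → trans (ℕΣ.sum-cong-≗ (λ m → sum-hit (vert p m))) (sum-ones (Cycle.len (cycle p)))) ⟩
      ℕΣ.sum (λ p → Cycle.len (cycle p))
        ∎
      where open ≡-Reasoning

    isOne : ℚ → ℕ
    isOne q = if ⌊ q ℚP.≟ 1ℚ ⌋ then 1 else 0

    isOne-≢1 : ∀ {q} → q ≢ 1ℚ → isOne q ≡ 0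
    isOne-≢1 {q} q≢1 with q ℚP.≟ 1ℚ
    ... | yes q≡1 = ⊥-elim (q≢1 q≡1)
    ... | no _ = refl

    isOne-0∨1 : ∀ {q} → q ≡ 0ℚ ⊎ q ≡ 1ℚ → ℕ→ℚ (isOne q) ≡ q
    isOne-0∨1 {q} q∈01 with q ℚP.≟ 1ℚ
    ... | yes q≡1 = sym q≡1
    ... | no q≢1 = sym ([ (λ q≡0 → q≡0) , (λ q≡1 → ⊥-elim (q≢1 q≡1)) ]′ q∈01)

    ones : Fin n → Fin n → ℕ
    ones i j = isOne (h i j)

    -- the fractional part of h: ½ on the cycle edges, 0 elsewhere
    fractionalPart : Point n
    fractionalPart i j = h i j ℚ.- ℕ→ℚ (ones i j)

    fractionalPart-off : ∀ i j → ¬ Fractional i j → fractionalPart i j ≡ 0ℚ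
    fractionalPart-off i j ¬frac = trans (cong (λ x → h i j ℚ.- x) (isOne-0∨1 h∈01)) (ℚP.+-inverseʳ (h i j))
      where
      h∈01 : h i j ≡ 0ℚ ⊎ h i j ≡ 1ℚ
      h∈01 with i ≟ j
      ... | yes refl = inj₁ (h-diag i)
      ... | no i≢j = ¬Fractional⇒0∨1 i≢j ¬frac

    colSum-fractionalPart : ∀ j → colSum fractionalPart j ≡ ℕ→ℚ (covers j)
    colSum-fractionalPart j = by-cases (FinP.any? (λ p → FinP.any? (λ m → vert p m ≟ j)))
      where
      by-cases : Dec (∃₂ λ p m → vert p m ≡ j) → colSum fractionalPart j ≡ ℕ→ℚ (covers j)
      by-cases (yes (p , m , refl)) = begin
        colSum fractionalPart v
          ≡⟨ colSum-split fractionalPart ⟩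
        fractionalPart a v ℚ.+ (fractionalPart b v ℚ.+ ℚΣ.sum (offCycle fractionalPart))
          ≡⟨ cong₂ (λ x y → x ℚ.+ (y ℚ.+ ℚΣ.sum (offCycle fractionalPart))) (on-cycle a-fractional) (on-cycle b-fractional) ⟩
        ½ ℚ.+ (½ ℚ.+ ℚΣ.sum (offCycle fractionalPart))
          ≡⟨ cong (λ s → ½ ℚ.+ (½ ℚ.+ s))
                  (ℚΣ.sum-zero _ (offCycle-pointwise fractionalPart (_≡ 0ℚ) refl (λ i → fractionalPart-off i v))) ⟩
        ½ ℚ.+ (½ ℚ.+ 0ℚ)
          ≡⟨ solve 0 (con ½ :+ (con ½ :+ con 0ℚ) := con 1ℚ) refl ⟩
        1ℚ
          ≡⟨ cong ℕ→ℚ (covers-on p m) ⟨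
        ℕ→ℚ (covers v)
          ∎
        where
        open ≡-Reasoning
        open AtVertex p m
        on-cycle : ∀ {i} → Fractional i v → fractionalPart i v ≡ ½
        on-cycle frac = trans (cong₂ (λ x k → x ℚ.- ℕ→ℚ k) (decomposition⇒half frac) (isOne-≢1 (proj₂ (proj₂ frac))))
                              (solve 1 (λ x → x :- con 0ℚ := x) refl ½)
      by-cases (no uncovered) = trans (ℚΣ.sum-zero _ (λ i → fractionalPart-off i j (λ frac → uncovered (ends-on-cycle frac))))
                                 (cong ℕ→ℚ (sym (covers-off j (λ (p , m , eq) → uncovered (p , m , eq)))))
        where
        ends-on-cycle : ∀ {i} → Fractional i j → ∃ λ p → ∃ λ m → vert p m ≡ j
        ends-on-cycle frac with fractional-on-cycle (Fractional-sym frac)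
        ... | p , m , eq , _ = p , m , eq

    degree-split : ∀ j → d j ≡ covers j + ℕΣ.sum (λ i → ones i j)
    degree-split j = ℕ→ℚ-injective (begin
      ℕ→ℚ (d j)
        ≡⟨ h-colSum j ⟨
      colSum h j
        ≡⟨ ℚΣ.sum-cong-≗ (λ i → solve 2 (λ x y → x := x :- y :+ y) refl (h i j) (ℕ→ℚ (ones i j))) ⟩
      ℚΣ.sum (λ i → fractionalPart i j ℚ.+ ℕ→ℚ (ones i j))
        ≡⟨ ℚΣ.∑-distrib-+ (λ i → fractionalPart i j) (λ i → ℕ→ℚ (ones i j)) ⟩
      colSum fractionalPart j ℚ.+ ℚΣ.sum (λ i → ℕ→ℚ (ones i j))
        ≡⟨ cong₂ ℚ._+_ (colSum-fractionalPart j) (ℕ→ℚ-sum (λ i → ones i j)) ⟩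
      ℕ→ℚ (covers j) ℚ.+ ℕ→ℚ (ℕΣ.sum (λ i → ones i j))
        ≡⟨ ℕ→ℚ-+ (covers j) _ ⟨
      ℕ→ℚ (covers j + ℕΣ.sum (λ i → ones i j))
        ∎)
      where open ≡-Reasoning

    -- Σ d and Σ ones are even by the handshake lemma, so Σ covers, a sum of |Cs| odd cycle lengths, is even.
    decomposition⇒even : Graphic d → length Cs ℕ.% 2 ≡ 0
    decomposition⇒even (G , degree≡d) = parity≡0ℙ⇒%2≡0 (length Cs) (begin
      parity (length Cs)                                       ≡⟨ parity-sum-odd (λ p → Cycle.len (cycle p)) cycle-odd ⟨
      parity (ℕΣ.sum (λ p → Cycle.len (cycle p)))              ≡⟨ cong parity sum-covers ⟨
      parity (ℕΣ.sum covers)                                   ≡⟨ ℙP.+-identityʳ _ ⟨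
      parity (ℕΣ.sum covers) ℙ.+ 0ℙ                            ≡⟨ cong (parity (ℕΣ.sum covers) ℙ.+_) ones-even ⟨
      parity (ℕΣ.sum covers) ℙ.+ parity (ℕΣ.sum ones-degree)   ≡⟨ ℙP.+-homo-+ (ℕΣ.sum covers) _ ⟨
      parity (ℕΣ.sum covers + ℕΣ.sum ones-degree)              ≡⟨ cong parity d-split ⟨
      parity (ℕΣ.sum d)                                        ≡⟨ d-even ⟩
      0ℙ                                                       ∎)
      where
      open ≡-Reasoning
      ones-degree : Fin n → ℕ
      ones-degree j = ℕΣ.sum (λ i → ones i j)
      d-split : ℕΣ.sum d ≡ ℕΣ.sum covers + ℕΣ.sum ones-degree
      d-split = trans (ℕΣ.sum-cong-≗ degree-split) (ℕΣ.∑-distrib-+ covers ones-degree)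
      ones-even : parity (ℕΣ.sum ones-degree) ≡ 0ℙ
      ones-even = handshake ones (λ i j → cong isOne (h-sym i j))
                    (λ i → trans (cong isOne (h-diag i)) (isOne-≢1 (ℚP.1≢0 ∘ sym)))
      adjacency : Fin n → Fin n → ℕ
      adjacency i j = boolToℕ (SimpleGraph.adj G i j)
      d-even : parity (ℕΣ.sum d) ≡ 0ℙ
      d-even = trans (cong parity (ℕΣ.sum-cong-≗ (λ j → trans (sym (degree≡d j)) (sumℕ≡∑ (λ i → adjacency i j)))))
                 (handshake adjacency (λ i j → cong boolToℕ (SimpleGraph.sym G i j)) (λ i → cong boolToℕ (SimpleGraph.irrefl G i)))

  module FromRigidity (rigid : Rigid) where
    open OddCycleStructure Fractional Fractional-sym Fractional-irrefl fractional-branch (rigid⇒no-even-closed-walk rigid)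

    fractional-chordless : ∀ C → FractionalCycle C → Chordless C
    fractional-chordless C fractional m {b} frac = by-cases (b ≟ Cycle.vert C (next m)) (b ≟ Cycle.vert C (prev m))
      where
      by-cases : Dec (b ≡ Cycle.vert C (next m)) → Dec (b ≡ Cycle.vert C (prev m)) →
                 b ≡ Cycle.vert C (next m) ⊎ b ≡ Cycle.vert C (prev m)
      by-cases (yes b≡next) _ = inj₁ b≡next
      by-cases (no _) (yes b≡prev) = inj₂ b≡prev
      by-cases (no b≢next) (no b≢prev) =
        ⊥-elim (at-most-two-neighbours (fractional (CycSucc-next m)) (Fractional-sym (fractional (CycSucc-prev m))) frac
                  (next≢prev-vert C m) (b≢next ∘ sym) (b≢prev ∘ sym))

    Meets : Cycle n → Fin n → Set
    Meets C v = ∃ λ m → Cycle.vert C m ≡ v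

    Disjoint : Cycle n → Cycle n → Set
    Disjoint C D = ∀ a b → Cycle.vert C a ≢ Cycle.vert D b

    chordless-closed : ∀ D → FractionalCycle D → ∀ {x y} → Meets D x → Fractional x y → Meets D y
    chordless-closed D fractional (m , refl) frac =
      [ (λ y≡next → next m , sym y≡next) , (λ y≡prev → prev m , sym y≡prev) ]′ (fractional-chordless D fractional m frac)

    meets⇒root : ∀ {v} (C : RootedCycle v) D → FractionalCycle D → ∀ k (k<len : k ℕ.< Cycle.len (toCycle C)) →
                 Meets D (Cycle.vert (toCycle C) (Fin.fromℕ< k<len)) → Meets D v
    meets⇒root C D fractional zero _ meets = meets
    meets⇒root C D fractional (suc k) k+1<len meets =
      meets⇒root C D fractional k k<len (chordless-closed D fractional meets (Fractional-sym (toCycle-edges C (inj₁ step))))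
      where
      k<len : k ℕ.< Cycle.len (toCycle C)
      k<len = ℕP.<-trans (ℕP.n<1+n k) k+1<len
      step : suc (toℕ (Fin.fromℕ< k<len)) ≡ toℕ (Fin.fromℕ< k+1<len)
      step = trans (cong suc (FinP.toℕ-fromℕ< k<len)) (sym (FinP.toℕ-fromℕ< k+1<len))

    disjoint-from-uncovering : ∀ {v} (C : RootedCycle v) Cs → All FractionalCycle Cs → ¬ Any (λ D → Meets D v) Cs →
                               All (Disjoint (toCycle C)) Cs
    disjoint-from-uncovering {v} C Cs fractional uncovered = All.tabulate λ {D} D∈Cs a b same →
      uncovered (Any.map (λ { refl → meets⇒root C D (All.lookup fractional D∈Cs) (Fin.toℕ a) (FinP.toℕ<n a)
                                       (b , trans (sym same) (cong (Cycle.vert (toCycle C)) (sym (FinP.fromℕ<-toℕ a (FinP.toℕ<n a))))) })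
                         D∈Cs)

    record Invariant (vs : List (Fin n)) (Cs : List (Cycle n)) : Set where
      field
        fractional : All FractionalCycle Cs
        odd : All (λ C → parity (Cycle.len C) ≡ 1ℙ) Cs
        disjoint : AllPairs Disjoint Cs
        covering : ∀ {v} → v ∈ vs → ∀ {w} → Fractional v w → Any (λ C → Meets C v) Cs

    build : ∀ vs → ∃ (Invariant vs)
    build [] = [] , record { fractional = [] ; odd = [] ; disjoint = [] ; covering = λ () }
    build (v ∷ vs) = extend (proj₂ (build vs)) (FinP.any? (Fractional? v))
      where
      extend : ∀ {Cs} → Invariant vs Cs → Dec (∃ (Fractional v)) → ∃ (Invariant (v ∷ vs))
      extend {Cs} inv (no isolated) = Cs , record
        { fractional = fractional ; odd = odd ; disjoint = disjoint
        ; covering = λ { (here refl) frac → ⊥-elim (isolated (_ , frac)) ; (there v∈) → covering v∈ } }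
        where open Invariant inv
      extend {Cs} inv (yes (w , frac)) with Any.any? (λ C → FinP.any? (λ m → Cycle.vert C m ≟ v)) Cs
      ... | yes covered = Cs , record
        { fractional = fractional ; odd = odd ; disjoint = disjoint
        ; covering = λ { (here refl) _ → covered ; (there v∈) → covering v∈ } }
        where open Invariant inv
      ... | no uncovered = toCycle C ∷ Cs , record
        { fractional = (λ succ → toCycle-edges C succ) ∷ fractional ; odd = toCycle-odd C ∷ odd
        ; disjoint = disjoint-from-uncovering C Cs fractional uncovered ∷ disjoint
        ; covering = λ { (here refl) _ → here (zero , refl) ; (there v∈) frac′ → there (covering v∈ frac′) } }
        where
        open Invariant inv
        C : RootedCycle v
        C = proj₁ (edge-on-cycle frac)

    decomposition : ∃ λ Cs → OddCycleDecomposition h Cs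
    decomposition = Cs , odd′ , disjoint′ , edges
      where
      Cs : List (Cycle n)
      Cs = proj₁ (build (List.allFin n))
      open Invariant (proj₂ (build (List.allFin n)))
      odd′ : ∀ p → OddCycle (List.lookup Cs p)
      odd′ p = parity≡1ℙ⇒%2≡1 (Cycle.len (List.lookup Cs p)) (All.lookup odd (∈-lookup p))
      disjoint′ : ∀ p q → p ≢ q → Disjoint (List.lookup Cs p) (List.lookup Cs q)
      disjoint′ p q p≢q = AllPairs-lookup (λ disj a b same → disj b a (sym same)) disjoint p≢q
      edges : ∀ i j → (REdge h i j → ∃ λ p → CycleEdge (List.lookup Cs p) i j) ×
                      ((∃ λ p → CycleEdge (List.lookup Cs p) i j) → REdge h i j)
      edges i j = to , from
        where
        to : REdge h i j → ∃ λ p → CycleEdge (List.lookup Cs p) i j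
        to redge = on-cycle (Any.index meets) (AnyP.lookup-index meets)
          where
          frac : Fractional i j
          frac = REdge⇒Fractional redge
          meets : Any (λ C → Meets C i) Cs
          meets = covering (∈-allFin i) frac
          on-cycle : ∀ p → Meets (List.lookup Cs p) i → ∃ λ p → CycleEdge (List.lookup Cs p) i j
          on-cycle p (m , refl) with fractional-chordless (List.lookup Cs p) (All.lookup fractional (∈-lookup p)) m frac
          ... | inj₁ j≡next = p , m , next m , CycSucc-next m , inj₁ (refl , sym j≡next)
          ... | inj₂ j≡prev = p , prev m , m , CycSucc-prev m , inj₂ (sym j≡prev , refl)
        from : (∃ λ p → CycleEdge (List.lookup Cs p) i j) → REdge h i j
        from (p , m , m′ , succ , inj₁ (refl , refl)) = Fractional⇒REdge (All.lookup fractional (∈-lookup p) succ)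
        from (p , m , m′ , succ , inj₂ (refl , refl)) = Fractional⇒REdge (Fractional-sym (All.lookup fractional (∈-lookup p) succ))

theorem1 : (n : ℕ) (d : Fin n → ℕ) → Graphic d →
    (h : Point n) → InP d h →
      (IsVertex d h ⇔ (∃ λ (Cs : List (Cycle n)) → OddCycleDecomposition h Cs))
    × (IsVertex d h →
         (∀ (Cs : List (Cycle n)) → OddCycleDecomposition h Cs → length Cs % 2 ≡ 0)
       × (∀ i j → REdge h i j → h i j ≡ ½))
theorem1 n d graphic h h∈P =
  mk⇔ vertex⇒decomposition decomposition⇒vertex ,
  λ vertex → (λ Cs dec → FromDecomposition.decomposition⇒even Cs dec graphic) ,
             (λ i j redge → let (Cs , dec) = vertex⇒decomposition vertex in
                            FromDecomposition.decomposition⇒half Cs dec (REdge⇒Fractional redge))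
  where
  open Polytope d h h∈P
  open CycleDecompositions d h h∈P
  vertex⇒decomposition : IsVertex d h → ∃ λ Cs → OddCycleDecomposition h Cs
  vertex⇒decomposition vertex = FromRigidity.decomposition (vertex⇒rigid vertex)
  decomposition⇒vertex : (∃ λ Cs → OddCycleDecomposition h Cs) → IsVertex d h
  decomposition⇒vertex (Cs , dec) = rigid⇒vertex (FromDecomposition.decomposition⇒rigid Cs dec)
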